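{- $(\mathbb{Q}[\mu]\langle Y\rangle,\ast_\mu)$ is a commutative and associative $\mathbb{Q}[\mu]$-algebra with unit $1$.
   Context: Fix $\mu\in\mathbb{C}$ with $\mathrm{Re}(\mu)>0$; $\mathbb{Q}[\mu]\subset\mathbb{C}$ the ring generated by $\mu$. $Y=\{y_{k,m}:k\in\mathbb{N},m\in\mathbb{Q}_{>0}\}$; $\mathbb{Q}[\mu]\langle Y\rangle$ is the free $\mathbb{Q}[\mu]$-module on all words over $Y$ (empty word $1$), with concatenation. On the span of letters define the bilinear product $\odot$: $y_{k_1,m}\odot y_{k_2,m}=y_{k_1+k_2,m}$, and for $m_1\ne m_2$, $y_{k_1,m_1}\odot y_{k_2,m_2}=\sum_{i=1}^{k_1}a_iy_{i,m_1}+\sum_{j=1}^{k_2}b_jy_{j,m_2}$ with $\frac{1}{(x+m_1)^{k_1}(x+m_2)^{k_2}}=\sum_{i}\frac{a_i}{(x+m_1)^i}+\sum_j\frac{b_j}{(x+m_2)^j}$. The $\mu$-stuffle product $\ast_\mu$ is the $\mathbb{Q}[\mu]$-bilinear map on $\mathbb{Q}[\mu]\langle Y\rangle$ defined recursively by $1\ast_\mu w=w\ast_\mu1=w$ for all words $w$ and $ux\ast_\mu vy=(u\ast_\mu vy)x+(ux\ast_\mu v)y-\mu\,(u\ast_\mu v)(x\odot y)$ for letters $x,y\in Y$ and words $u,v$ (concatenation extended bilinearly). -}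

module Defs where

open import Level using (Level; _⊔_)
open import Algebra.Bundles using (CommutativeRing)
open import Algebra.Morphism.Structures using (IsRingHomomorphism)
open import Data.Nat.Base as ℕ using (ℕ; zero; suc)
import Data.Nat.Properties as ℕP
open import Data.Rational.Base as ℚ using (ℚ; Positive)
import Data.Rational.Properties as ℚP
open import Data.Product.Base using (_×_; _,_)
open import Data.List.Base using (List; []; _∷_; map; concatMap; _++_)
open import Relation.Nullary using (¬_; yes; no)
open import Relation.Binary.Definitions using (DecidableEquality)
open import Relation.Binary.PropositionalEquality using (_≡_; refl; cong)

_^ℚ_ : ℚ → ℕ → ℚ
q ^ℚ zero  = ℚ.1ℚ
q ^ℚ suc n = q ℚ.* (q ^ℚ n)

sum₁ : ℕ → (ℕ → ℚ) → ℚ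
sum₁ zero    f = ℚ.0ℚ
sum₁ (suc n) f = sum₁ n f ℚ.+ f (suc n)

-- Letters y_{k,m}, k ∈ ℕ = {1,2,...}, m ∈ ℚ_{>0}.
-- The index k is stored as its predecessor: letter pk m represents
-- y_{pk+1, m}.  The positivity proof is irrelevant, so letters are
-- equal iff their k and m agree.

record Letter : Set where
  constructor letter
  field
    pk   : ℕ
    m    : ℚ
    .pos : Positive m

open Letter public

kOf : Letter → ℕ
kOf x = suc (pk x)

_≟L_ : DecidableEquality Letter
letter k m _ ≟L letter k′ m′ _ with k ℕP.≟ k′ | m ℚP.≟ m′
... | yes refl | yes refl = yes refl
... | no k≢    | _        = no λ eq → k≢ (cong pk eq)
... | yes _    | no m≢    = no λ eq → m≢ (cong Letter.m eq)

-- Words over Y, as snoc-lists (so that "u x" = word u followed by letter x).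
infixl 5 _▸_
data Word : Set where
  []  : Word
  _▸_ : Word → Letter → Word

_++w_ : Word → Word → Word
u ++w []      = u
u ++w (v ▸ y) = (u ++w v) ▸ y

_≟W_ : DecidableEquality Word
[]      ≟W []      = yes refl
[]      ≟W (_ ▸ _) = no λ ()
(_ ▸ _) ≟W []      = no λ ()
(u ▸ x) ≟W (v ▸ y) with u ≟W v | x ≟L y
... | yes refl | yes refl = yes refl
... | no u≢    | _        = no λ { refl → u≢ refl }
... | yes _    | no x≢    = no λ { refl → x≢ refl }

-- A k₁ m₁ k₂ m₂ i = a_i and B k₁ m₁ k₂ m₂ j = b_j in
--   1/((x+m₁)^k₁ (x+m₂)^k₂) = Σ_{i=1}^{k₁} a_i/(x+m₁)^i + Σ_{j=1}^{k₂} b_j/(x+m₂)^j ,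
-- stated after clearing denominators as an identity for all x ∈ ℚ.

Coeffs : Set
Coeffs = ℕ → ℚ → ℕ → ℚ → ℕ → ℚ

IsPartialFraction : Coeffs → Coeffs → Set
IsPartialFraction A B =
  ∀ (k₁ k₂ : ℕ) (m₁ m₂ : ℚ) → Positive m₁ → Positive m₂ → ¬ (m₁ ≡ m₂) →
  ∀ (x : ℚ) →
    ℚ.1ℚ ≡ sum₁ (suc k₁) (λ i → A (suc k₁) m₁ (suc k₂) m₂ i
                                 ℚ.* ((x ℚ.+ m₁) ^ℚ (suc k₁ ℕ.∸ i))
                                 ℚ.* ((x ℚ.+ m₂) ^ℚ (suc k₂)))
         ℚ.+ sum₁ (suc k₂) (λ j → B (suc k₁) m₁ (suc k₂) m₂ j
                                 ℚ.* ((x ℚ.+ m₁) ^ℚ (suc k₁))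
                                 ℚ.* ((x ℚ.+ m₂) ^ℚ (suc k₂ ℕ.∸ j)))

-- Elements are finite formal R-linear combinations of words, represented
-- as lists of (coefficient, word); two are identified (≈ₚ) iff every word
-- has the same total coefficient.

module Stuffle {c ℓ : Level} (R : CommutativeRing c ℓ)
               (ι : ℚ → CommutativeRing.Carrier R)
               (μ : CommutativeRing.Carrier R)
               (A B : Coeffs) where

  open CommutativeRing R

  Poly : Set c
  Poly = List (Carrier × Word)

  one : Poly
  one = (1# , []) ∷ []

  infixr 7 _•_
  _•_ : Carrier → Poly → Poly
  r • p = map (λ { (d , w) → (r * d , w) }) p

  _·ˡ_ : Poly → Letter → Poly
  p ·ˡ x = map (λ { (d , w) → (d , w ▸ x) }) p

  _·ₚ_ : Poly → Poly → Poly
  p ·ₚ q = concatMap (λ { (d , u) → map (λ { (e , v) → (d * e , u ++w v) }) q }) p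

  coeff : Poly → Word → Carrier
  coeff []             w = 0#
  coeff ((d , u) ∷ p)  w with u ≟W w
  ... | yes _ = d + coeff p w
  ... | no  _ = coeff p w

  infix 4 _≈ₚ_
  _≈ₚ_ : Poly → Poly → Set ℓ
  p ≈ₚ q = ∀ w → coeff p w ≈ coeff q w

  letters : (n : ℕ) (f : ℕ → ℚ) (m : ℚ) → .(Positive m) → Poly
  letters zero    f m pos = []
  letters (suc n) f m pos = letters n f m pos ++ ((ι (f (suc n)) , [] ▸ letter n m pos) ∷ [])

  _⊙_ : Letter → Letter → Poly
  letter k₁ m₁ p₁ ⊙ letter k₂ m₂ p₂ with m₁ ℚP.≟ m₂
  ... | yes _ = (1# , [] ▸ letter (suc k₁ ℕ.+ k₂) m₁ p₁) ∷ []
  ... | no  _ = letters (suc k₁) (A (suc k₁) m₁ (suc k₂) m₂) m₁ p₁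
             ++ letters (suc k₂) (B (suc k₁) m₁ (suc k₂) m₂) m₂ p₂

  _∗w_ : Word → Word → Poly
  []      ∗w v       = (1# , v) ∷ []
  (u ▸ x) ∗w []      = (1# , u ▸ x) ∷ []
  (u ▸ x) ∗w (v ▸ y) =
       ((u ∗w (v ▸ y)) ·ˡ x)
    ++ (((u ▸ x) ∗w v) ·ˡ y)
    ++ ((- μ) • ((u ∗w v) ·ₚ (x ⊙ y)))

  infixl 7 _∗_
  _∗_ : Poly → Poly → Poly
  p ∗ q = concatMap (λ { (d , u) → concatMap (λ { (e , v) → (d * e) • (u ∗w v) }) q }) p

  record IsCommAssocUnitalAlgebra : Set (c ⊔ ℓ) where
    field
      ∗-cong      : ∀ {p p′ q q′} → p ≈ₚ p′ → q ≈ₚ q′ → p ∗ q ≈ₚ p′ ∗ q′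
      ∗-distribʳ  : ∀ p p′ q → (p ++ p′) ∗ q ≈ₚ (p ∗ q) ++ (p′ ∗ q)
      ∗-distribˡ  : ∀ p q q′ → p ∗ (q ++ q′) ≈ₚ (p ∗ q) ++ (p ∗ q′)
      ∗-scalarˡ   : ∀ r p q → (r • p) ∗ q ≈ₚ r • (p ∗ q)
      ∗-scalarʳ   : ∀ r p q → p ∗ (r • q) ≈ₚ r • (p ∗ q)
      ∗-assoc     : ∀ p q s → (p ∗ q) ∗ s ≈ₚ p ∗ (q ∗ s)
      ∗-comm      : ∀ p q → p ∗ q ≈ₚ q ∗ p
      ∗-identityˡ : ∀ p → one ∗ p ≈ₚ p
      ∗-identityʳ : ∀ p → p ∗ one ≈ₚ p

-- The product ∗ is the bilinear extension of ∗w, so formal sums are compared through the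
-- linear functionals f ↦ Σ d f(u) they define (≋), which is the same as comparing coefficients (≈ₚ). Commutativity and associativity follow from the
-- recursion ux ∗ vy = (u ∗ vy)x + (ux ∗ v)y − μ(u ∗ v)(x ⊙ y) by the usual quasi-shuffle induction on
-- words, once ⊙ is commutative and associative; for associativity both bracketings of a triple product
-- expand into seven terms that match pairwise. The laws of ⊙ come from the valuation
-- y_{k,m} ↦ 1/(x + m)^k (x ≥ 0): the partial-fraction identity makes it turn ⊙ into multiplication, and
-- it is injective on combinations of letters by uniqueness of partial fractions. Clearing denominators
-- yields a polynomial that vanishes for all x ≥ 0, hence at x = −m, where only the coefficient of the
-- letter y_{k,m} with k maximal survives. These identities hold over ℚ and are transported to R along ι.

module Submission where

open import Defs
open import Level using (Level)
open import Algebra.Bundles using (CommutativeRing)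
open import Algebra.Morphism.Structures using (IsRingHomomorphism)
open import Data.Rational.Base using (ℚ; +-*-rawRing)
open import Data.Maybe.Base using (nothing)
import Algebra.Solver.Ring.AlmostCommutativeRing as ACR
import Algebra.Solver.Ring as RingSolver
import Data.Rational.Properties as ℚP
import Data.Nat.Properties as ℕP
open import Data.Product.Base using (Σ; _×_; _,_; proj₁; proj₂)
open import Data.List.Base using (List; []; _∷_; map; concatMap; _++_; deduplicate)
open import Data.List.Relation.Unary.All as All using (All; []; _∷_)
open import Data.List.Relation.Unary.Any using (here; there)
open import Data.List.Relation.Unary.AllPairs using (_∷_)
open import Data.List.Relation.Unary.Unique.Propositional using (Unique)
open import Data.List.Relation.Unary.Unique.DecPropositional.Properties using (deduplicate-!)
open import Data.List.Membership.Propositional using (_∈_; _∉_)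
open import Data.List.Membership.Propositional.Properties using (∈-++⁺ˡ; ∈-++⁺ʳ; ∈-deduplicate⁺)
open import Relation.Nullary using (yes; no)
open import Relation.Binary.Bundles using (Setoid)
open import Relation.Binary.PropositionalEquality as ≡ using (_≡_)
open import Data.Empty using (⊥-elim)
open import Data.Nat.Base as ℕ using (ℕ; zero; suc)

module Sums {c ℓ : Level} (R : CommutativeRing c ℓ) where
  open CommutativeRing R
  open import Algebra.Properties.CommutativeSemigroup +-commutativeSemigroup using (interchange)

  ∑ : {X : Set} → List X → (X → Carrier) → Carrier
  ∑ []       g = 0#
  ∑ (x ∷ xs) g = g x + ∑ xs g

  ∑-cong : {X : Set} (xs : List X) {g h : X → Carrier} → (∀ x → g x ≈ h x) → ∑ xs g ≈ ∑ xs h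
  ∑-cong []       e = refl
  ∑-cong (x ∷ xs) e = +-cong (e x) (∑-cong xs e)

  ∑-map : {X Y : Set} (f : X → Y) (xs : List X) (g : Y → Carrier) → ∑ (map f xs) g ≡ ∑ xs (λ x → g (f x))
  ∑-map f []       g = ≡.refl
  ∑-map f (x ∷ xs) g = ≡.cong (g (f x) +_) (∑-map f xs g)

  ∑-0 : {X : Set} (xs : List X) → ∑ xs (λ _ → 0#) ≈ 0#
  ∑-0 []       = refl
  ∑-0 (_ ∷ xs) = trans (+-identityˡ _) (∑-0 xs)

  ∑-+ : {X : Set} (xs : List X) (g h : X → Carrier) → ∑ xs (λ x → g x + h x) ≈ ∑ xs g + ∑ xs h
  ∑-+ []       g h = sym (+-identityʳ _)
  ∑-+ (x ∷ xs) g h = trans (+-congˡ (∑-+ xs g h)) (interchange _ _ _ _)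

module Evaluation {c ℓ : Level} (R : CommutativeRing c ℓ)
              (ι : ℚ → CommutativeRing.Carrier R)
              (μ : CommutativeRing.Carrier R)
              (A B : Coeffs) where
  open CommutativeRing R
  open Stuffle R ι μ A B
  open import Relation.Binary.Reasoning.Setoid setoid
  open import Algebra.Properties.CommutativeSemigroup +-commutativeSemigroup using (interchange)
  open import Algebra.Properties.CommutativeSemigroup *-commutativeSemigroup using (x∙yz≈y∙xz)

  eval : Poly → (Word → Carrier) → Carrier
  eval []            f = 0#
  eval ((d , u) ∷ p) f = d * f u + eval p f

  infix 4 _≋_
  record _≋_ (p q : Poly) : Set (c Level.⊔ ℓ) where
    constructor by-eval
    field eval-≈ : ∀ f → eval p f ≈ eval q f
  open _≋_ public

  ≋-setoid : Setoid c (c Level.⊔ ℓ)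
  ≋-setoid = record
    { Carrier       = Poly
    ; _≈_           = _≋_
    ; isEquivalence = record
      { refl  = by-eval λ _ → refl
      ; sym   = λ e → by-eval λ f → sym (eval-≈ e f)
      ; trans = λ e e′ → by-eval λ f → trans (eval-≈ e f) (eval-≈ e′ f)
      }
    }
  open Setoid ≋-setoid public using () renaming (refl to ≋-refl; sym to ≋-sym; trans to ≋-trans)

  eval-++ : ∀ p q f → eval (p ++ q) f ≈ eval p f + eval q f
  eval-++ []            q f = sym (+-identityˡ _)
  eval-++ ((d , u) ∷ p) q f = trans (+-congˡ (eval-++ p q f)) (sym (+-assoc _ _ _))

  eval-• : ∀ r p f → eval (r • p) f ≈ r * eval p f
  eval-• r []            f = sym (zeroʳ r)
  eval-• r ((d , u) ∷ p) f = trans (+-cong (*-assoc _ _ _) (eval-• r p f)) (sym (distribˡ _ _ _))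

  eval-·ˡ : ∀ p a f → eval (p ·ˡ a) f ≈ eval p (λ u → f (u ▸ a))
  eval-·ˡ []            a f = refl
  eval-·ˡ ((d , u) ∷ p) a f = +-congˡ (eval-·ˡ p a f)

  eval-cong : ∀ p {f g} → (∀ u → f u ≈ g u) → eval p f ≈ eval p g
  eval-cong []            e = refl
  eval-cong ((d , u) ∷ p) e = +-cong (*-congˡ (e u)) (eval-cong p e)

  eval-+ : ∀ p f g → eval p (λ u → f u + g u) ≈ eval p f + eval p g
  eval-+ []            f g = sym (+-identityʳ _)
  eval-+ ((d , u) ∷ p) f g = trans (+-cong (distribˡ _ _ _) (eval-+ p f g)) (interchange _ _ _ _)

  eval-* : ∀ p r f → eval p (λ u → r * f u) ≈ r * eval p f
  eval-* []            r f = sym (zeroʳ r)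
  eval-* ((d , u) ∷ p) r f =
    trans (+-cong (x∙yz≈y∙xz d r (f u)) (eval-* p r f)) (sym (distribˡ _ _ _))

  eval-0 : ∀ p → eval p (λ _ → 0#) ≈ 0#
  eval-0 []            = refl
  eval-0 ((d , u) ∷ p) = trans (+-cong (zeroʳ d) (eval-0 p)) (+-identityʳ _)

  eval-swap : ∀ p q (h : Word → Word → Carrier) →
              eval p (λ u → eval q (h u)) ≈ eval q (λ v → eval p (λ u → h u v))
  eval-swap []            q h = sym (eval-0 q)
  eval-swap ((d , u) ∷ p) q h = begin
      d * eval q (h u) + eval p (λ u → eval q (h u))
    ≈⟨ +-cong (sym (eval-* q d (h u))) (eval-swap p q h) ⟩
      eval q (λ v → d * h u v) + eval q (λ v → eval p (λ u → h u v))
    ≈⟨ sym (eval-+ q _ _) ⟩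
      eval q (λ v → d * h u v + eval p (λ u → h u v)) ∎

  ⌜_⌝ : Word → Poly
  ⌜ u ⌝ = (1# , u) ∷ []

  eval-⌜⌝ : ∀ u f → eval ⌜ u ⌝ f ≈ f u
  eval-⌜⌝ u f = trans (+-identityʳ _) (*-identityˡ _)

  open Sums R

  δ : Word → Word → Carrier
  δ w u = coeff ⌜ u ⌝ w

  coeff≈eval-δ : ∀ p w → coeff p w ≈ eval p (δ w)
  coeff≈eval-δ []            w = refl
  coeff≈eval-δ ((d , u) ∷ p) w with u ≟W w
  ... | yes _ = +-cong (sym (trans (*-congˡ (+-identityʳ 1#)) (*-identityʳ d))) (coeff≈eval-δ p w)
  ... | no  _ = trans (coeff≈eval-δ p w) (sym (trans (+-congʳ (zeroʳ d)) (+-identityˡ _)))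

  ≋⇒≈ₚ : ∀ {p q} → p ≋ q → p ≈ₚ q
  ≋⇒≈ₚ {p} {q} e w = trans (coeff≈eval-δ p w) (trans (eval-≈ e (δ w)) (sym (coeff≈eval-δ q w)))

  support : Poly → List Word
  support = map proj₂

  coeff-∷ : ∀ d u p v → coeff ((d , u) ∷ p) v ≈ coeff ((d , u) ∷ []) v + coeff p v
  coeff-∷ d u p v with u ≟W v
  ... | yes _ = +-congʳ (sym (+-identityʳ d))
  ... | no  _ = sym (+-identityˡ _)

  ∑-coeff-∉ : ∀ d u (f : Word → Carrier) ws → u ∉ ws → ∑ ws (λ v → coeff ((d , u) ∷ []) v * f v) ≈ 0#
  ∑-coeff-∉ d u f []       u∉ = refl
  ∑-coeff-∉ d u f (v ∷ ws) u∉ with u ≟W v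
  ... | yes u≡v = ⊥-elim (u∉ (here u≡v))
  ... | no  _   = trans (+-cong (zeroˡ _) (∑-coeff-∉ d u f ws (λ m → u∉ (there m)))) (+-identityʳ _)

  ∑-coeff-∈ : ∀ d u (f : Word → Carrier) ws → Unique ws → u ∈ ws → ∑ ws (λ v → coeff ((d , u) ∷ []) v * f v) ≈ d * f u
  ∑-coeff-∈ d u f (v ∷ ws) (v∉ ∷ uq) u∈ with u ≟W v
  ... | yes ≡.refl = trans (+-cong (*-congʳ (+-identityʳ d)) (∑-coeff-∉ d u f ws λ m → All.lookup v∉ m ≡.refl))
                           (+-identityʳ _)
  ∑-coeff-∈ d u f (v ∷ ws) (v∉ ∷ uq) (here u≡v) | no u≢v = ⊥-elim (u≢v u≡v)
  ∑-coeff-∈ d u f (v ∷ ws) (v∉ ∷ uq) (there u∈) | no _   =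
    trans (+-cong (zeroˡ _) (∑-coeff-∈ d u f ws uq u∈)) (+-identityˡ _)

  eval≈∑-coeff : ∀ ws p f → Unique ws → (∀ {v} → v ∈ support p → v ∈ ws) →
                 eval p f ≈ ∑ ws (λ v → coeff p v * f v)
  eval≈∑-coeff ws []            f uq ⊆ws =
    sym (trans (∑-cong ws (λ v → zeroˡ (f v))) (∑-0 ws))
  eval≈∑-coeff ws ((d , u) ∷ p) f uq ⊆ws = begin
      d * f u + eval p f
    ≈⟨ +-cong (sym (∑-coeff-∈ d u f ws uq (⊆ws (here ≡.refl))))
              (eval≈∑-coeff ws p f uq (λ m → ⊆ws (there m))) ⟩
      ∑ ws (λ v → coeff ((d , u) ∷ []) v * f v) + ∑ ws (λ v → coeff p v * f v)
    ≈⟨ ∑-+ ws _ _ ⟨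
      ∑ ws (λ v → coeff ((d , u) ∷ []) v * f v + coeff p v * f v)
    ≈⟨ ∑-cong ws (λ v → trans (sym (distribʳ (f v) _ _)) (*-congʳ (sym (coeff-∷ d u p v)))) ⟩
      ∑ ws (λ v → coeff ((d , u) ∷ p) v * f v) ∎

  ≈ₚ⇒≋ : ∀ {p q} → p ≈ₚ q → p ≋ q
  ≈ₚ⇒≋ {p} {q} e = by-eval λ f → begin
      eval p f
    ≈⟨ eval≈∑-coeff ws p f uq (λ m → ∈-deduplicate⁺ _≟W_ (∈-++⁺ˡ m)) ⟩
      ∑ ws (λ v → coeff p v * f v)
    ≈⟨ ∑-cong ws (λ v → *-congʳ (e v)) ⟩
      ∑ ws (λ v → coeff q v * f v)
    ≈⟨ eval≈∑-coeff ws q f uq (λ m → ∈-deduplicate⁺ _≟W_ (∈-++⁺ʳ (support p) m)) ⟨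
      eval q f ∎
    where ws : List Word
          ws = deduplicate _≟W_ (support p ++ support q)
          uq : Unique ws
          uq = deduplicate-! _≟W_ (support p ++ support q)

  coeff-∉ : ∀ p w → w ∉ support p → coeff p w ≈ 0#
  coeff-∉ []            w w∉ = refl
  coeff-∉ ((d , u) ∷ p) w w∉ with u ≟W w
  ... | yes u≡w = ⊥-elim (w∉ (here (≡.sym u≡w)))
  ... | no  _   = coeff-∉ p w (λ w∈ → w∉ (there w∈))

  coeff-++ : ∀ p q w → coeff (p ++ q) w ≈ coeff p w + coeff q w
  coeff-++ p q w = trans (coeff≈eval-δ (p ++ q) w)
                         (trans (eval-++ p q (δ w)) (sym (+-cong (coeff≈eval-δ p w) (coeff≈eval-δ q w))))

  coeff-• : ∀ r p w → coeff (r • p) w ≈ r * coeff p w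
  coeff-• r p w = trans (coeff≈eval-δ (r • p) w) (trans (eval-• r p (δ w)) (sym (*-congˡ (coeff≈eval-δ p w))))

  bilinear : (Word → Word → Poly) → Poly → Poly → Poly
  bilinear F p q = concatMap (λ { (d , u) → concatMap (λ { (e , v) → (d * e) • F u v }) q }) p

  eval-bilinear : ∀ F p q f → eval (bilinear F p q) f ≈ eval p (λ u → eval q (λ v → eval (F u v) f))
  eval-bilinear F []            q f = refl
  eval-bilinear F ((d , u) ∷ p) q f = begin
      eval (row q ++ bilinear F p q) f
    ≈⟨ eval-++ (row q) _ f ⟩
      eval (row q) f + eval (bilinear F p q) f
    ≈⟨ +-cong (eval-row q) (eval-bilinear F p q f) ⟩
      d * eval q (λ v → eval (F u v) f) + eval p (λ u → eval q (λ v → eval (F u v) f)) ∎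
    where
    row : Poly → Poly
    row q = concatMap (λ { (e , v) → (d * e) • F u v }) q
    eval-row : ∀ q → eval (row q) f ≈ d * eval q (λ v → eval (F u v) f)
    eval-row []            = sym (zeroʳ d)
    eval-row ((e , v) ∷ q) = begin
        eval ((d * e) • F u v ++ row q) f
      ≈⟨ eval-++ ((d * e) • F u v) (row q) f ⟩
        eval ((d * e) • F u v) f + eval (row q) f
      ≈⟨ +-cong (trans (eval-• (d * e) (F u v) f) (*-assoc _ _ _)) (eval-row q) ⟩
        d * (e * eval (F u v) f) + d * eval q (λ v → eval (F u v) f)
      ≈⟨ distribˡ _ _ _ ⟨
        d * (e * eval (F u v) f + eval q (λ v → eval (F u v) f)) ∎

  eval-∗ : ∀ p q f → eval (p ∗ q) f ≈ eval p (λ u → eval q (λ v → eval (u ∗w v) f))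
  eval-∗ = eval-bilinear _∗w_

  eval-·ₚ : ∀ p q f → eval (p ·ₚ q) f ≈ eval p (λ u → eval q (λ v → f (u ++w v)))
  eval-·ₚ []            q f = refl
  eval-·ₚ ((d , u) ∷ p) q f = trans (eval-++ (shift q) _ f) (+-cong (eval-shift q) (eval-·ₚ p q f))
    where
    shift : Poly → Poly
    shift q = map (λ { (e , v) → (d * e , u ++w v) }) q
    eval-shift : ∀ q → eval (shift q) f ≈ d * eval q (λ v → f (u ++w v))
    eval-shift []            = sym (zeroʳ d)
    eval-shift ((e , v) ∷ q) = trans (+-cong (*-assoc _ _ _) (eval-shift q)) (sym (distribˡ _ _ _))

  -- ⊙ extended by zero to words that are not letters, then bilinearly to R⟨Y⟩
  _⊙ʷ_ : Word → Word → Poly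
  ([] ▸ a) ⊙ʷ ([] ▸ b) = a ⊙ b
  _        ⊙ʷ _        = []

  infixl 7 _⊙ₚ_
  _⊙ₚ_ : Poly → Poly → Poly
  _⊙ₚ_ = bilinear _⊙ʷ_

  ++-cong : ∀ {p p′ q q′} → p ≋ p′ → q ≋ q′ → p ++ q ≋ p′ ++ q′
  ++-cong {p} {p′} {q} {q′} e e′ = by-eval λ f →
    trans (eval-++ p q f) (trans (+-cong (eval-≈ e f) (eval-≈ e′ f)) (sym (eval-++ p′ q′ f)))

  •-cong : ∀ r {p p′} → p ≋ p′ → r • p ≋ r • p′
  •-cong r {p} {p′} e = by-eval λ f →
    trans (eval-• r p f) (trans (*-congˡ (eval-≈ e f)) (sym (eval-• r p′ f)))

  ·ₚ-cong : ∀ {p p′ q q′} → p ≋ p′ → q ≋ q′ → p ·ₚ q ≋ p′ ·ₚ q′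
  ·ₚ-cong {p} {p′} {q} {q′} e e′ = by-eval λ f → begin
      eval (p ·ₚ q) f                                   ≈⟨ eval-·ₚ p q f ⟩
      eval p (λ u → eval q (λ v → f (u ++w v)))         ≈⟨ eval-cong p (λ u → eval-≈ e′ _) ⟩
      eval p (λ u → eval q′ (λ v → f (u ++w v)))        ≈⟨ eval-≈ e _ ⟩
      eval p′ (λ u → eval q′ (λ v → f (u ++w v)))       ≈⟨ eval-·ₚ p′ q′ f ⟨
      eval (p′ ·ₚ q′) f                                 ∎

  bilinear-cong : ∀ F {p p′ q q′} → p ≋ p′ → q ≋ q′ → bilinear F p q ≋ bilinear F p′ q′
  bilinear-cong F {p} {p′} {q} {q′} e e′ = by-eval λ f → begin
      eval (bilinear F p q) f                              ≈⟨ eval-bilinear F p q f ⟩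
      eval p (λ u → eval q (λ v → eval (F u v) f))         ≈⟨ eval-cong p (λ u → eval-≈ e′ _) ⟩
      eval p (λ u → eval q′ (λ v → eval (F u v) f))        ≈⟨ eval-≈ e _ ⟩
      eval p′ (λ u → eval q′ (λ v → eval (F u v) f))       ≈⟨ eval-bilinear F p′ q′ f ⟨
      eval (bilinear F p′ q′) f                            ∎

  bilinear-comm : ∀ F → (∀ u v → F u v ≋ F v u) → ∀ p q → bilinear F p q ≋ bilinear F q p
  bilinear-comm F F-comm p q = by-eval λ f → begin
      eval (bilinear F p q) f                              ≈⟨ eval-bilinear F p q f ⟩
      eval p (λ u → eval q (λ v → eval (F u v) f))         ≈⟨ eval-cong p (λ u → eval-cong q (λ v → eval-≈ (F-comm u v) f)) ⟩
      eval p (λ u → eval q (λ v → eval (F v u) f))         ≈⟨ eval-swap p q (λ u v → eval (F v u) f) ⟩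
      eval q (λ v → eval p (λ u → eval (F v u) f))         ≈⟨ eval-bilinear F q p f ⟨
      eval (bilinear F q p) f                              ∎

  ∗-cong : ∀ {p p′ q q′} → p ≋ p′ → q ≋ q′ → p ∗ q ≋ p′ ∗ q′
  ∗-cong = bilinear-cong _∗w_

  ⊙ₚ-cong : ∀ {p p′ q q′} → p ≋ p′ → q ≋ q′ → p ⊙ₚ q ≋ p′ ⊙ₚ q′
  ⊙ₚ-cong = bilinear-cong _⊙ʷ_

  IsLetter : Word → Set
  IsLetter w = Σ Letter (λ a → w ≡ [] ▸ a)

  LetterComb : Poly → Set c
  LetterComb = All (λ t → IsLetter (proj₂ t))

  eval-congᴸ : ∀ {p f g} → LetterComb p → (∀ a → f ([] ▸ a) ≈ g ([] ▸ a)) → eval p f ≈ eval p g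
  eval-congᴸ []                   e = refl
  eval-congᴸ ((a , ≡.refl) ∷ isL) e = +-cong (*-congˡ (e a)) (eval-congᴸ isL e)

  ++-letterComb : ∀ {p q} → LetterComb p → LetterComb q → LetterComb (p ++ q)
  ++-letterComb []         isL′ = isL′
  ++-letterComb (l ∷ isL) isL′ = l ∷ ++-letterComb isL isL′

  •-letterComb : ∀ r {p} → LetterComb p → LetterComb (r • p)
  •-letterComb r []         = []
  •-letterComb r (l ∷ isL) = l ∷ •-letterComb r isL

  letters-letterComb : ∀ n f m .pos → LetterComb (letters n f m pos)
  letters-letterComb zero    f m pos = []
  letters-letterComb (suc n) f m pos = ++-letterComb (letters-letterComb n f m pos) ((_ , ≡.refl) ∷ [])

  ⊙-letterComb : ∀ a b → LetterComb (a ⊙ b)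
  ⊙-letterComb (letter k₁ m₁ p₁) (letter k₂ m₂ p₂) with m₁ ℚP.≟ m₂
  ... | yes _ = (_ , ≡.refl) ∷ []
  ... | no  _ = ++-letterComb (letters-letterComb (suc k₁) (A (suc k₁) m₁ (suc k₂) m₂) m₁ p₁)
                              (letters-letterComb (suc k₂) (B (suc k₁) m₁ (suc k₂) m₂) m₂ p₂)

  ⊙ₚ-letterComb : ∀ p q → LetterComb (p ⊙ₚ q)
  ⊙ₚ-letterComb []            q = []
  ⊙ₚ-letterComb ((d , u) ∷ p) q = ++-letterComb (row q) (⊙ₚ-letterComb p q)
    where
    row : ∀ q → LetterComb (concatMap (λ { (e , v) → (d * e) • (u ⊙ʷ v) }) q)
    row []            = []
    row ((e , v) ∷ q) = ++-letterComb (•-letterComb (d * e) (⊙ʷ-letterComb u v)) (row q)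
      where
      ⊙ʷ-letterComb : ∀ u v → LetterComb (u ⊙ʷ v)
      ⊙ʷ-letterComb ([] ▸ a)      ([] ▸ b)      = ⊙-letterComb a b
      ⊙ʷ-letterComb []            _             = []
      ⊙ʷ-letterComb ((_ ▸ _) ▸ _) _             = []
      ⊙ʷ-letterComb ([] ▸ _)      []            = []
      ⊙ʷ-letterComb ([] ▸ _)      ((_ ▸ _) ▸ _) = []

  ⌜_⌝ˡ : Letter → Poly
  ⌜ a ⌝ˡ = ⌜ [] ▸ a ⌝

  ⌜⌝ˡ-letterComb : ∀ a → LetterComb ⌜ a ⌝ˡ
  ⌜⌝ˡ-letterComb a = (a , ≡.refl) ∷ []

  ⌜▸⌝≋⌜⌝·ₚ⌜⌝ˡ : ∀ u a → ⌜ u ▸ a ⌝ ≋ ⌜ u ⌝ ·ₚ ⌜ a ⌝ˡ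
  ⌜▸⌝≋⌜⌝·ₚ⌜⌝ˡ u a = by-eval λ f → begin
      eval ⌜ u ▸ a ⌝ f                                        ≈⟨ eval-⌜⌝ (u ▸ a) f ⟩
      f (u ▸ a)                                               ≈⟨ eval-⌜⌝ (u ▸ a) f ⟨
      eval ⌜ a ⌝ˡ (λ l → f (u ++w l))                          ≈⟨ eval-⌜⌝ u (λ u′ → eval ⌜ a ⌝ˡ (λ l → f (u′ ++w l))) ⟨
      eval ⌜ u ⌝ (λ u′ → eval ⌜ a ⌝ˡ (λ l → f (u′ ++w l)))     ≈⟨ eval-·ₚ ⌜ u ⌝ ⌜ a ⌝ˡ f ⟨
      eval (⌜ u ⌝ ·ₚ ⌜ a ⌝ˡ) f                                 ∎

  ⌜⌝ˡ⊙ₚ⌜⌝ˡ : ∀ a b → ⌜ a ⌝ˡ ⊙ₚ ⌜ b ⌝ˡ ≋ a ⊙ b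
  ⌜⌝ˡ⊙ₚ⌜⌝ˡ a b = by-eval λ f →
    trans (eval-bilinear _⊙ʷ_ ⌜ a ⌝ˡ ⌜ b ⌝ˡ f)
          (trans (eval-⌜⌝ ([] ▸ a) (λ u → eval ⌜ b ⌝ˡ (λ v → eval (u ⊙ʷ v) f)))
                 (eval-⌜⌝ ([] ▸ b) (λ v → eval (([] ▸ a) ⊙ʷ v) f)))

module StuffleLaws {c ℓ : Level} (R : CommutativeRing c ℓ)
                   (ι : ℚ → CommutativeRing.Carrier R)
                   (μ : CommutativeRing.Carrier R)
                   (A B : Coeffs) where
  open CommutativeRing R
  open Stuffle R ι μ A B
  open Evaluation R ι μ A B
  open import Relation.Binary.Reasoning.Setoid setoid
  open RingSolver (ACR.AlmostCommutativeRing.rawRing (ACR.fromCommutativeRing R))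
                  (ACR.fromCommutativeRing R)
                  (ACR.-raw-almostCommutative⟶ (ACR.fromCommutativeRing R))
                  (λ _ _ → nothing)
    using (solve; _:+_; _:*_; _:=_)
  open import Algebra.Properties.CommutativeSemigroup +-commutativeSemigroup using (x∙yz≈y∙xz)

  ∗-identityˡ : ∀ p → one ∗ p ≋ p
  ∗-identityˡ p = by-eval λ f →
    trans (eval-∗ one p f) (trans (+-identityʳ _) (trans (*-identityˡ _) (eval-cong p (λ v → eval-⌜⌝ v f))))

  ∗-identityʳ : ∀ p → p ∗ one ≋ p
  ∗-identityʳ p = by-eval λ f →
    trans (eval-∗ p one f) (eval-cong p (λ u → trans (eval-⌜⌝ [] (λ v → eval (u ∗w v) f)) (∗w-[] u f)))
    where ∗w-[] : ∀ u f → eval (u ∗w []) f ≈ f u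
          ∗w-[] []      f = eval-⌜⌝ [] f
          ∗w-[] (u ▸ x) f = eval-⌜⌝ (u ▸ x) f

  eval-∗w-▸ : ∀ u v a b f →
    eval ((u ▸ a) ∗w (v ▸ b)) f ≈
      eval (u ∗w (v ▸ b)) (λ s → f (s ▸ a))
      + (eval ((u ▸ a) ∗w v) (λ s → f (s ▸ b))
         + (- μ) * eval (u ∗w v) (λ s → eval (a ⊙ b) (λ r → f (s ++w r))))
  eval-∗w-▸ u v a b f = begin
      eval (X ++ Y ++ (- μ) • Z) f                 ≈⟨ eval-++ X (Y ++ (- μ) • Z) f ⟩
      eval X f + eval (Y ++ (- μ) • Z) f           ≈⟨ +-congˡ (eval-++ Y ((- μ) • Z) f) ⟩
      eval X f + (eval Y f + eval ((- μ) • Z) f)   ≈⟨ +-cong (eval-·ˡ (u ∗w (v ▸ b)) a f)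
                                                        (+-cong (eval-·ˡ ((u ▸ a) ∗w v) b f)
                                                          (trans (eval-• (- μ) Z f) (*-congˡ (eval-·ₚ (u ∗w v) (a ⊙ b) f)))) ⟩
      _                                            ∎
    where X Y Z : Poly
          X = (u ∗w (v ▸ b)) ·ˡ a
          Y = ((u ▸ a) ∗w v) ·ˡ b
          Z = (u ∗w v) ·ₚ (a ⊙ b)

  ∑⁴ : Poly → Poly → Poly → Poly → (Word → Word → Word → Word → Carrier) → Carrier
  ∑⁴ P L Q M h = eval P λ u → eval L λ l → eval Q λ v → eval M λ m → h u l v m

  ∑⁴-+ : ∀ P L Q M h h′ → ∑⁴ P L Q M (λ u l v m → h u l v m + h′ u l v m) ≈ ∑⁴ P L Q M h + ∑⁴ P L Q M h′
  ∑⁴-+ P L Q M h h′ =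
    trans (eval-cong P λ u → trans (eval-cong L λ l → trans (eval-cong Q λ v → eval-+ M _ _)
                                                             (eval-+ Q _ _))
                                   (eval-+ L _ _))
          (eval-+ P _ _)

  ∑⁴-* : ∀ P L Q M r h → ∑⁴ P L Q M (λ u l v m → r * h u l v m) ≈ r * ∑⁴ P L Q M h
  ∑⁴-* P L Q M r h =
    trans (eval-cong P λ u → trans (eval-cong L λ l → trans (eval-cong Q λ v → eval-* M r _)
                                                             (eval-* Q r _))
                                   (eval-* L r _))
          (eval-* P r _)

  -- Opaque so that unification sees Σ₃ and Σ₇ instead of the underlying lists.
  opaque
    Σ₃ : Poly → Poly → Poly → Poly
    Σ₃ p q r = p ++ q ++ (- μ) • r

    eval-Σ₃ : ∀ p q r f → eval (Σ₃ p q r) f ≈ eval p f + (eval q f + (- μ) * eval r f)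
    eval-Σ₃ p q r f = trans (eval-++ p _ f) (+-congˡ (trans (eval-++ q _ f) (+-congˡ (eval-• (- μ) r f))))

    Σ₃-cong : ∀ {p p′ q q′ r r′} → p ≋ p′ → q ≋ q′ → r ≋ r′ → Σ₃ p q r ≋ Σ₃ p′ q′ r′
    Σ₃-cong e e′ e″ = ++-cong e (++-cong e′ (•-cong (- μ) e″))

    Σ₇ : Poly → Poly → Poly → Poly → Poly → Poly → Poly → Poly
    Σ₇ t₁ t₂ t₃ t₄ t₅ t₆ t₇ = t₁ ++ t₂ ++ t₃ ++ (- μ) • t₄ ++ (- μ) • t₅ ++ (- μ) • t₆ ++ (- μ) • ((- μ) • t₇)

    Σ₇-cong : ∀ {t₁ t₂ t₃ t₄ t₅ t₆ t₇ t₁′ t₂′ t₃′ t₄′ t₅′ t₆′ t₇′} →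
              t₁ ≋ t₁′ → t₂ ≋ t₂′ → t₃ ≋ t₃′ → t₄ ≋ t₄′ → t₅ ≋ t₅′ → t₆ ≋ t₆′ → t₇ ≋ t₇′ →
              Σ₇ t₁ t₂ t₃ t₄ t₅ t₆ t₇ ≋ Σ₇ t₁′ t₂′ t₃′ t₄′ t₅′ t₆′ t₇′
    Σ₇-cong e₁ e₂ e₃ e₄ e₅ e₆ e₇ =
      ++-cong e₁ (++-cong e₂ (++-cong e₃ (++-cong (•-cong _ e₄) (++-cong (•-cong _ e₅) (++-cong (•-cong _ e₆) (•-cong _ (•-cong _ e₇)))))))

    eval-Σ₇ : ∀ t₁ t₂ t₃ t₄ t₅ t₆ t₇ f →
      eval (Σ₇ t₁ t₂ t₃ t₄ t₅ t₆ t₇) f ≈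
        eval t₁ f + (eval t₂ f + (eval t₃ f + ((- μ) * eval t₄ f + ((- μ) * eval t₅ f
          + ((- μ) * eval t₆ f + (- μ) * ((- μ) * eval t₇ f))))))
    eval-Σ₇ t₁ t₂ t₃ t₄ t₅ t₆ t₇ f =
      trans (eval-++ t₁ _ f) (+-congˡ (trans (eval-++ t₂ _ f) (+-congˡ (trans (eval-++ t₃ _ f) (+-congˡ
        (trans (eval-++ ((- μ) • t₄) _ f) (+-cong (eval-• _ t₄ f)
        (trans (eval-++ ((- μ) • t₅) _ f) (+-cong (eval-• _ t₅ f)
        (trans (eval-++ ((- μ) • t₆) _ f) (+-cong (eval-• _ t₆ f) (trans (eval-• _ ((- μ) • t₇) f) (*-congˡ (eval-• _ t₇ f))))))))))))))

  module LinearMap (Φ : Poly → Poly) (φ : (Word → Carrier) → Word → Carrier)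
                   (eval-Φ : ∀ p f → eval (Φ p) f ≈ eval p (φ f)) where

    ++-homo : ∀ p q → Φ (p ++ q) ≋ Φ p ++ Φ q
    ++-homo p q = by-eval λ f → begin
      eval (Φ (p ++ q)) f               ≈⟨ eval-Φ (p ++ q) f ⟩
      eval (p ++ q) (φ f)               ≈⟨ eval-++ p q (φ f) ⟩
      eval p (φ f) + eval q (φ f)       ≈⟨ +-cong (eval-Φ p f) (eval-Φ q f) ⟨
      eval (Φ p) f + eval (Φ q) f       ≈⟨ eval-++ (Φ p) (Φ q) f ⟨
      eval (Φ p ++ Φ q) f               ∎

    •-homo : ∀ r p → Φ (r • p) ≋ r • Φ p
    •-homo r p = by-eval λ f → begin
      eval (Φ (r • p)) f                ≈⟨ eval-Φ (r • p) f ⟩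
      eval (r • p) (φ f)                ≈⟨ eval-• r p (φ f) ⟩
      r * eval p (φ f)                  ≈⟨ *-congˡ (eval-Φ p f) ⟨
      r * eval (Φ p) f                  ≈⟨ eval-• r (Φ p) f ⟨
      eval (r • Φ p) f                  ∎

    Σ₃-homo : ∀ p q r → Φ (Σ₃ p q r) ≋ Σ₃ (Φ p) (Φ q) (Φ r)
    Σ₃-homo p q r = by-eval λ f → begin
      eval (Φ (Σ₃ p q r)) f                                   ≈⟨ eval-Φ (Σ₃ p q r) f ⟩
      eval (Σ₃ p q r) (φ f)                                   ≈⟨ eval-Σ₃ p q r (φ f) ⟩
      eval p (φ f) + (eval q (φ f) + (- μ) * eval r (φ f))    ≈⟨ +-cong (eval-Φ p f) (+-cong (eval-Φ q f) (*-congˡ (eval-Φ r f))) ⟨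
      eval (Φ p) f + (eval (Φ q) f + (- μ) * eval (Φ r) f)    ≈⟨ eval-Σ₃ (Φ p) (Φ q) (Φ r) f ⟨
      eval (Σ₃ (Φ p) (Φ q) (Φ r)) f                           ∎

  eval-∗ʳ : ∀ p q f → eval (p ∗ q) f ≈ eval q (λ v → eval p (λ u → eval (u ∗w v) f))
  eval-∗ʳ p q f = trans (eval-∗ p q f) (eval-swap p q _)

  module ∗ʳ q = LinearMap (_∗ q) _ (λ p → eval-∗ p q)
  module ∗ˡ p = LinearMap (p ∗_) _ (eval-∗ʳ p)
  module ·ₚʳ q = LinearMap (_·ₚ q) _ (λ p → eval-·ₚ p q)

  ∗-distribʳ : ∀ p p′ q → (p ++ p′) ∗ q ≋ (p ∗ q) ++ (p′ ∗ q)
  ∗-distribʳ p p′ q = ∗ʳ.++-homo q p p′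

  ∗-distribˡ : ∀ p q q′ → p ∗ (q ++ q′) ≋ (p ∗ q) ++ (p ∗ q′)
  ∗-distribˡ p = ∗ˡ.++-homo p

  ∗-scalarˡ : ∀ r p q → (r • p) ∗ q ≋ r • (p ∗ q)
  ∗-scalarˡ r p q = ∗ʳ.•-homo q r p

  ∗-scalarʳ : ∀ r p q → p ∗ (r • q) ≋ r • (p ∗ q)
  ∗-scalarʳ r p q = ∗ˡ.•-homo p r q

  ∗-Σ₃ˡ : ∀ p q r s → Σ₃ p q r ∗ s ≋ Σ₃ (p ∗ s) (q ∗ s) (r ∗ s)
  ∗-Σ₃ˡ p q r s = ∗ʳ.Σ₃-homo s p q r

  ∗-Σ₃ʳ : ∀ s p q r → s ∗ Σ₃ p q r ≋ Σ₃ (s ∗ p) (s ∗ q) (s ∗ r)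
  ∗-Σ₃ʳ = ∗ˡ.Σ₃-homo

  ·ₚ-Σ₃ˡ : ∀ p q r s → Σ₃ p q r ·ₚ s ≋ Σ₃ (p ·ₚ s) (q ·ₚ s) (r ·ₚ s)
  ·ₚ-Σ₃ˡ p q r s = ·ₚʳ.Σ₃-homo s p q r

  module StuffleRecursion (P Q L M : Poly) where
    X Y Z : Poly
    X = (P ∗ (Q ·ₚ M)) ·ₚ L
    Y = ((P ·ₚ L) ∗ Q) ·ₚ M
    Z = (P ∗ Q) ·ₚ (L ⊙ₚ M)
    t₁ t₂ t₃ : (Word → Carrier) → Word → Word → Word → Word → Carrier
    t₁ f u l v m = eval (u ∗w (v ++w m)) (λ s → f (s ++w l))
    t₂ f u l v m = eval ((u ++w l) ∗w v) (λ s → f (s ++w m))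
    t₃ f u l v m = eval (u ∗w v) (λ s → eval (l ⊙ʷ m) (λ r → f (s ++w r)))

    eval-product : ∀ f → eval ((P ·ₚ L) ∗ (Q ·ₚ M)) f ≈ ∑⁴ P L Q M (λ u l v m → eval ((u ++w l) ∗w (v ++w m)) f)
    eval-product f = begin
      eval ((P ·ₚ L) ∗ (Q ·ₚ M)) f                                          ≈⟨ eval-∗ (P ·ₚ L) (Q ·ₚ M) f ⟩
      eval (P ·ₚ L) (λ s → eval (Q ·ₚ M) (λ t → eval (s ∗w t) f))            ≈⟨ eval-·ₚ P L _ ⟩
      eval P (λ u → eval L (λ l → eval (Q ·ₚ M) (λ t → eval ((u ++w l) ∗w t) f)))
        ≈⟨ (eval-cong P λ u → eval-cong L λ l → eval-·ₚ Q M _) ⟩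
      ∑⁴ P L Q M (λ u l v m → eval ((u ++w l) ∗w (v ++w m)) f)              ∎

    eval-X : ∀ f → eval X f ≈ ∑⁴ P L Q M (t₁ f)
    eval-X f = begin
      eval X f                                                         ≈⟨ eval-·ₚ (P ∗ (Q ·ₚ M)) L f ⟩
      eval (P ∗ (Q ·ₚ M)) (λ s → eval L (λ l → f (s ++w l)))           ≈⟨ eval-∗ P (Q ·ₚ M) _ ⟩
      eval P (λ u → eval (Q ·ₚ M) (λ t → eval (u ∗w t) _))             ≈⟨ (eval-cong P λ u → eval-·ₚ Q M _) ⟩
      eval P (λ u → eval Q λ v → eval M λ m → eval (u ∗w (v ++w m)) (λ s → eval L (λ l → f (s ++w l))))
        ≈⟨ (eval-cong P λ u → trans (eval-cong Q λ v → trans (eval-cong M λ m → eval-swap (u ∗w (v ++w m)) L _)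
                                                            (eval-swap M L _))
                                    (eval-swap Q L _)) ⟩
      ∑⁴ P L Q M (t₁ f)                                                ∎

    eval-Y : ∀ f → eval Y f ≈ ∑⁴ P L Q M (t₂ f)
    eval-Y f = begin
      eval Y f                                                         ≈⟨ eval-·ₚ ((P ·ₚ L) ∗ Q) M f ⟩
      eval ((P ·ₚ L) ∗ Q) (λ s → eval M (λ m → f (s ++w m)))           ≈⟨ eval-∗ (P ·ₚ L) Q _ ⟩
      eval (P ·ₚ L) (λ t → eval Q (λ v → eval (t ∗w v) _))             ≈⟨ eval-·ₚ P L _ ⟩
      eval P (λ u → eval L λ l → eval Q λ v → eval ((u ++w l) ∗w v) (λ s → eval M (λ m → f (s ++w m))))
        ≈⟨ (eval-cong P λ u → eval-cong L λ l → eval-cong Q λ v → eval-swap ((u ++w l) ∗w v) M _) ⟩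
      ∑⁴ P L Q M (t₂ f)                                                ∎

    eval-Z : ∀ f → eval Z f ≈ ∑⁴ P L Q M (t₃ f)
    eval-Z f = begin
      eval Z f                                                         ≈⟨ eval-·ₚ (P ∗ Q) (L ⊙ₚ M) f ⟩
      eval (P ∗ Q) (λ s → eval (L ⊙ₚ M) (λ r → f (s ++w r)))           ≈⟨ eval-∗ P Q _ ⟩
      eval P (λ u → eval Q λ v → eval (u ∗w v) λ s → eval (L ⊙ₚ M) (λ r → f (s ++w r)))
        ≈⟨ (eval-cong P λ u → eval-cong Q λ v → eval-cong (u ∗w v) λ s → eval-bilinear _⊙ʷ_ L M _) ⟩
      eval P (λ u → eval Q λ v → eval (u ∗w v) λ s → eval L λ l → eval M λ m → eval (l ⊙ʷ m) (λ r → f (s ++w r)))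
        ≈⟨ (eval-cong P λ u → trans (eval-cong Q λ v → trans (eval-swap (u ∗w v) L _)
                                                            (eval-cong L λ l → eval-swap (u ∗w v) M _))
                                    (eval-swap Q L _)) ⟩
      ∑⁴ P L Q M (t₃ f)                                                ∎

    expand : LetterComb L → LetterComb M → (P ·ₚ L) ∗ (Q ·ₚ M) ≋ Σ₃ X Y Z
    expand isL isM = by-eval λ f → begin
        eval ((P ·ₚ L) ∗ (Q ·ₚ M)) f
      ≈⟨ eval-product f ⟩
        ∑⁴ P L Q M (λ u l v m → eval ((u ++w l) ∗w (v ++w m)) f)
      ≈⟨ (eval-cong P λ u → eval-congᴸ isL λ a → eval-cong Q λ v → eval-congᴸ isM λ b → eval-∗w-▸ u v a b f) ⟩
        ∑⁴ P L Q M (λ u l v m → t₁ f u l v m + (t₂ f u l v m + (- μ) * t₃ f u l v m))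
      ≈⟨ trans (∑⁴-+ P L Q M _ _) (+-congˡ (trans (∑⁴-+ P L Q M _ _) (+-congˡ (∑⁴-* P L Q M (- μ) _)))) ⟩
        ∑⁴ P L Q M (t₁ f) + (∑⁴ P L Q M (t₂ f) + (- μ) * ∑⁴ P L Q M (t₃ f))
      ≈⟨ +-cong (eval-X f) (+-cong (eval-Y f) (*-congˡ (eval-Z f))) ⟨
        eval X f + (eval Y f + (- μ) * eval Z f)
      ≈⟨ eval-Σ₃ X Y Z f ⟨
        eval (Σ₃ X Y Z) f ∎

  ∗-·ₚ-expand : ∀ P Q L M → LetterComb L → LetterComb M →
    (P ·ₚ L) ∗ (Q ·ₚ M) ≋ Σ₃ ((P ∗ (Q ·ₚ M)) ·ₚ L) (((P ·ₚ L) ∗ Q) ·ₚ M) ((P ∗ Q) ·ₚ (L ⊙ₚ M))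
  ∗-·ₚ-expand P Q L M = StuffleRecursion.expand P Q L M

  module _ (⊙-comm : ∀ a b → a ⊙ b ≋ b ⊙ a) where

    ∗w-comm : ∀ u v → u ∗w v ≋ v ∗w u
    ∗w-comm []      []      = ≋-refl
    ∗w-comm []      (v ▸ y) = ≋-refl
    ∗w-comm (u ▸ x) []      = ≋-refl
    ∗w-comm (u ▸ x) (v ▸ y) = by-eval λ f → begin
        eval ((u ▸ x) ∗w (v ▸ y)) f
      ≈⟨ eval-∗w-▸ u v x y f ⟩
        eval (u ∗w (v ▸ y)) _ + (eval ((u ▸ x) ∗w v) _ + (- μ) * eval (u ∗w v) (λ s → eval (x ⊙ y) _))
      ≈⟨ +-cong (eval-≈ (∗w-comm u (v ▸ y)) _)
                (+-cong (eval-≈ (∗w-comm (u ▸ x) v) _)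
                        (*-congˡ (trans (eval-≈ (∗w-comm u v) _) (eval-cong (v ∗w u) λ s → eval-≈ (⊙-comm x y) _)))) ⟩
        eval ((v ▸ y) ∗w u) _ + (eval (v ∗w (u ▸ x)) _ + (- μ) * eval (v ∗w u) (λ s → eval (y ⊙ x) _))
      ≈⟨ x∙yz≈y∙xz _ _ _ ⟩
        eval (v ∗w (u ▸ x)) _ + (eval ((v ▸ y) ∗w u) _ + (- μ) * eval (v ∗w u) (λ s → eval (y ⊙ x) _))
      ≈⟨ eval-∗w-▸ v u y x f ⟨
        eval ((v ▸ y) ∗w (u ▸ x)) f ∎

    ∗-comm : ∀ p q → p ∗ q ≋ q ∗ p
    ∗-comm = bilinear-comm _∗w_ ∗w-comm

  eval-Σ₃Σ₃ : ∀ a₁ b₁ c₁ a₂ b₂ c₂ a₃ b₃ c₃ f →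
    eval (Σ₃ (Σ₃ a₁ b₁ c₁) (Σ₃ a₂ b₂ c₂) (Σ₃ a₃ b₃ c₃)) f ≈
      (eval a₁ f + (eval b₁ f + (- μ) * eval c₁ f))
      + ((eval a₂ f + (eval b₂ f + (- μ) * eval c₂ f))
         + (- μ) * (eval a₃ f + (eval b₃ f + (- μ) * eval c₃ f)))
  eval-Σ₃Σ₃ a₁ b₁ c₁ a₂ b₂ c₂ a₃ b₃ c₃ f =
    trans (eval-Σ₃ (Σ₃ a₁ b₁ c₁) (Σ₃ a₂ b₂ c₂) (Σ₃ a₃ b₃ c₃) f)
          (+-cong (eval-Σ₃ a₁ b₁ c₁ f) (+-cong (eval-Σ₃ a₂ b₂ c₂ f) (*-congˡ (eval-Σ₃ a₃ b₃ c₃ f))))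

  Σ₃Σ₃-regroupˡ : ∀ a₁ b₁ c₁ a₂ b₂ c₂ a₃ b₃ c₃ →
    Σ₃ (Σ₃ a₁ b₁ c₁) (Σ₃ a₂ b₂ c₂) (Σ₃ a₃ b₃ c₃) ≋ Σ₇ a₁ a₂ (Σ₃ b₁ b₂ b₃) a₃ c₁ c₂ c₃
  Σ₃Σ₃-regroupˡ a₁ b₁ c₁ a₂ b₂ c₂ a₃ b₃ c₃ = by-eval λ f → begin
      eval (Σ₃ (Σ₃ a₁ b₁ c₁) (Σ₃ a₂ b₂ c₂) (Σ₃ a₃ b₃ c₃)) f
    ≈⟨ eval-Σ₃Σ₃ a₁ b₁ c₁ a₂ b₂ c₂ a₃ b₃ c₃ f ⟩
      _
    ≈⟨ solve 10 (λ A₁ B₁ C₁ A₂ B₂ C₂ A₃ B₃ C₃ m →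
                   (A₁ :+ (B₁ :+ m :* C₁)) :+ ((A₂ :+ (B₂ :+ m :* C₂)) :+ m :* (A₃ :+ (B₃ :+ m :* C₃)))
                := A₁ :+ (A₂ :+ ((B₁ :+ (B₂ :+ m :* B₃)) :+ (m :* A₃ :+ (m :* C₁ :+ (m :* C₂ :+ m :* (m :* C₃)))))))
                refl (eval a₁ f) (eval b₁ f) (eval c₁ f) (eval a₂ f) (eval b₂ f) (eval c₂ f)
                     (eval a₃ f) (eval b₃ f) (eval c₃ f) (- μ) ⟩
      _
    ≈⟨ trans (eval-Σ₇ a₁ a₂ (Σ₃ b₁ b₂ b₃) a₃ c₁ c₂ c₃ f) (+-congˡ (+-congˡ (+-congʳ (eval-Σ₃ b₁ b₂ b₃ f)))) ⟨
      eval (Σ₇ a₁ a₂ (Σ₃ b₁ b₂ b₃) a₃ c₁ c₂ c₃) f ∎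

  Σ₃Σ₃-regroupʳ : ∀ a₁ b₁ c₁ a₂ b₂ c₂ a₃ b₃ c₃ →
    Σ₃ (Σ₃ a₁ b₁ c₁) (Σ₃ a₂ b₂ c₂) (Σ₃ a₃ b₃ c₃) ≋ Σ₇ (Σ₃ a₁ a₂ a₃) b₁ b₂ c₁ c₂ b₃ c₃
  Σ₃Σ₃-regroupʳ a₁ b₁ c₁ a₂ b₂ c₂ a₃ b₃ c₃ = by-eval λ f → begin
      eval (Σ₃ (Σ₃ a₁ b₁ c₁) (Σ₃ a₂ b₂ c₂) (Σ₃ a₃ b₃ c₃)) f
    ≈⟨ eval-Σ₃Σ₃ a₁ b₁ c₁ a₂ b₂ c₂ a₃ b₃ c₃ f ⟩
      _
    ≈⟨ solve 10 (λ A₁ B₁ C₁ A₂ B₂ C₂ A₃ B₃ C₃ m →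
                   (A₁ :+ (B₁ :+ m :* C₁)) :+ ((A₂ :+ (B₂ :+ m :* C₂)) :+ m :* (A₃ :+ (B₃ :+ m :* C₃)))
                := (A₁ :+ (A₂ :+ m :* A₃)) :+ (B₁ :+ (B₂ :+ (m :* C₁ :+ (m :* C₂ :+ (m :* B₃ :+ m :* (m :* C₃)))))))
                refl (eval a₁ f) (eval b₁ f) (eval c₁ f) (eval a₂ f) (eval b₂ f) (eval c₂ f)
                     (eval a₃ f) (eval b₃ f) (eval c₃ f) (- μ) ⟩
      _
    ≈⟨ trans (eval-Σ₇ (Σ₃ a₁ a₂ a₃) b₁ b₂ c₁ c₂ b₃ c₃ f) (+-congʳ (eval-Σ₃ a₁ a₂ a₃ f)) ⟨
      eval (Σ₇ (Σ₃ a₁ a₂ a₃) b₁ b₂ c₁ c₂ b₃ c₃) f ∎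

  Assoc : Poly → Poly → Poly → Set (c Level.⊔ ℓ)
  Assoc p q s = (p ∗ q) ∗ s ≋ p ∗ (q ∗ s)

  Assoc-resp : ∀ {p p′ q q′ s s′} → p ≋ p′ → q ≋ q′ → s ≋ s′ → Assoc p q s → Assoc p′ q′ s′
  Assoc-resp e e′ e″ a =
    ≋-trans (∗-cong (∗-cong (≋-sym e) (≋-sym e′)) (≋-sym e″)) (≋-trans a (∗-cong e (∗-cong e′ e″)))

  ⌜⌝∗⌜⌝ : ∀ u v → ⌜ u ⌝ ∗ ⌜ v ⌝ ≋ u ∗w v
  ⌜⌝∗⌜⌝ u v = by-eval λ f →
    trans (eval-∗ ⌜ u ⌝ ⌜ v ⌝ f)
          (trans (eval-⌜⌝ u (λ u′ → eval ⌜ v ⌝ (λ v′ → eval (u′ ∗w v′) f))) (eval-⌜⌝ v (λ v′ → eval (u ∗w v′) f)))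

  eval-[∗]∗ : ∀ p q s f →
    eval ((p ∗ q) ∗ s) f ≈ eval p λ u → eval q λ v → eval s λ w → eval ((⌜ u ⌝ ∗ ⌜ v ⌝) ∗ ⌜ w ⌝) f
  eval-[∗]∗ p q s f = begin
      eval ((p ∗ q) ∗ s) f
    ≈⟨ eval-∗ (p ∗ q) s f ⟩
      eval (p ∗ q) (λ t → eval s λ w → eval (t ∗w w) f)
    ≈⟨ eval-∗ p q _ ⟩
      (eval p λ u → eval q λ v → eval (u ∗w v) λ t → eval s λ w → eval (t ∗w w) f)
    ≈⟨ (eval-cong p λ u → eval-cong q λ v → trans (eval-swap (u ∗w v) s _) (eval-cong s λ w → sym (basis u v w))) ⟩
      (eval p λ u → eval q λ v → eval s λ w → eval ((⌜ u ⌝ ∗ ⌜ v ⌝) ∗ ⌜ w ⌝) f) ∎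
    where
    basis : ∀ u v w → eval ((⌜ u ⌝ ∗ ⌜ v ⌝) ∗ ⌜ w ⌝) f ≈ eval (u ∗w v) (λ t → eval (t ∗w w) f)
    basis u v w = trans (eval-≈ (∗-cong (⌜⌝∗⌜⌝ u v) (≋-refl {⌜ w ⌝})) f)
                        (trans (eval-∗ (u ∗w v) ⌜ w ⌝ f) (eval-cong (u ∗w v) λ t → eval-⌜⌝ w (λ w′ → eval (t ∗w w′) f)))

  eval-∗[∗] : ∀ p q s f →
    eval (p ∗ (q ∗ s)) f ≈ eval p λ u → eval q λ v → eval s λ w → eval (⌜ u ⌝ ∗ (⌜ v ⌝ ∗ ⌜ w ⌝)) f
  eval-∗[∗] p q s f = begin
      eval (p ∗ (q ∗ s)) f
    ≈⟨ eval-∗ p (q ∗ s) f ⟩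
      (eval p λ u → eval (q ∗ s) λ t → eval (u ∗w t) f)
    ≈⟨ (eval-cong p λ u → eval-∗ q s _) ⟩
      (eval p λ u → eval q λ v → eval s λ w → eval (v ∗w w) λ t → eval (u ∗w t) f)
    ≈⟨ (eval-cong p λ u → eval-cong q λ v → eval-cong s λ w → sym (basis u v w)) ⟩
      (eval p λ u → eval q λ v → eval s λ w → eval (⌜ u ⌝ ∗ (⌜ v ⌝ ∗ ⌜ w ⌝)) f) ∎
    where
    basis : ∀ u v w → eval (⌜ u ⌝ ∗ (⌜ v ⌝ ∗ ⌜ w ⌝)) f ≈ eval (v ∗w w) (λ t → eval (u ∗w t) f)
    basis u v w = trans (eval-≈ (∗-cong (≋-refl {⌜ u ⌝}) (⌜⌝∗⌜⌝ v w)) f)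
                        (trans (eval-∗ ⌜ u ⌝ (v ∗w w) f) (eval-⌜⌝ u (λ u′ → eval (v ∗w w) (λ t → eval (u′ ∗w t) f))))

module StuffleAssoc {c ℓ : Level} (R : CommutativeRing c ℓ)
                    (ι : ℚ → CommutativeRing.Carrier R)
                    (μ : CommutativeRing.Carrier R)
                    (A B : Coeffs) where
  open CommutativeRing R using (-_)
  module R = CommutativeRing R
  open Stuffle R ι μ A B
  open Evaluation R ι μ A B
  open StuffleLaws R ι μ A B
  open import Relation.Binary.Reasoning.Setoid ≋-setoid

  module Expansion (U V S : Poly) (x y z : Letter) where

    x̂ ŷ ẑ X Y Z : Poly
    x̂ = ⌜ x ⌝ˡ
    ŷ = ⌜ y ⌝ˡ
    ẑ = ⌜ z ⌝ˡ
    X = U ·ₚ x̂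
    Y = V ·ₚ ŷ
    Z = S ·ₚ ẑ

    lx : LetterComb x̂
    ly : LetterComb ŷ
    lz : LetterComb ẑ
    lx = ⌜⌝ˡ-letterComb x
    ly = ⌜⌝ˡ-letterComb y
    lz = ⌜⌝ˡ-letterComb z

    expansion : (Poly → Poly → Poly → Poly) → Poly → Poly
    expansion F xyz = Σ₇ (F U Y Z ·ₚ x̂) (F X V Z ·ₚ ŷ) (F X Y S ·ₚ ẑ)
                         (F U V Z ·ₚ (x̂ ⊙ₚ ŷ)) (F U Y S ·ₚ (x̂ ⊙ₚ ẑ)) (F X V S ·ₚ (ŷ ⊙ₚ ẑ)) (F U V S ·ₚ xyz)

    expandˡ : (X ∗ Y) ∗ Z ≋ expansion (λ p q s → (p ∗ q) ∗ s) ((x̂ ⊙ₚ ŷ) ⊙ₚ ẑ)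
    expandˡ = begin
        (X ∗ Y) ∗ Z
      ≈⟨ ∗-cong (∗-·ₚ-expand U V x̂ ŷ lx ly) (≋-refl {Z}) ⟩
        Σ₃ T₁ T₂ W ∗ Z
      ≈⟨ ∗-Σ₃ˡ T₁ T₂ W Z ⟩
        Σ₃ (T₁ ∗ Z) (T₂ ∗ Z) (W ∗ Z)
      ≈⟨ Σ₃-cong (∗-·ₚ-expand (U ∗ Y) S x̂ ẑ lx lz) (∗-·ₚ-expand (X ∗ V) S ŷ ẑ ly lz)
                 (∗-·ₚ-expand (U ∗ V) S (x̂ ⊙ₚ ŷ) ẑ (⊙ₚ-letterComb x̂ ŷ) lz) ⟩
        Σ₃ (Σ₃ (((U ∗ Y) ∗ Z) ·ₚ x̂) ((T₁ ∗ S) ·ₚ ẑ) (((U ∗ Y) ∗ S) ·ₚ (x̂ ⊙ₚ ẑ)))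
           (Σ₃ (((X ∗ V) ∗ Z) ·ₚ ŷ) ((T₂ ∗ S) ·ₚ ẑ) (((X ∗ V) ∗ S) ·ₚ (ŷ ⊙ₚ ẑ)))
           (Σ₃ (((U ∗ V) ∗ Z) ·ₚ (x̂ ⊙ₚ ŷ)) ((W ∗ S) ·ₚ ẑ) (((U ∗ V) ∗ S) ·ₚ ((x̂ ⊙ₚ ŷ) ⊙ₚ ẑ)))
      ≈⟨ Σ₃Σ₃-regroupˡ (((U ∗ Y) ∗ Z) ·ₚ x̂) ((T₁ ∗ S) ·ₚ ẑ) (((U ∗ Y) ∗ S) ·ₚ (x̂ ⊙ₚ ẑ))
                       (((X ∗ V) ∗ Z) ·ₚ ŷ) ((T₂ ∗ S) ·ₚ ẑ) (((X ∗ V) ∗ S) ·ₚ (ŷ ⊙ₚ ẑ))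
                       (((U ∗ V) ∗ Z) ·ₚ (x̂ ⊙ₚ ŷ)) ((W ∗ S) ·ₚ ẑ) (((U ∗ V) ∗ S) ·ₚ ((x̂ ⊙ₚ ŷ) ⊙ₚ ẑ)) ⟩
        Σ₇ (((U ∗ Y) ∗ Z) ·ₚ x̂) (((X ∗ V) ∗ Z) ·ₚ ŷ) (Σ₃ ((T₁ ∗ S) ·ₚ ẑ) ((T₂ ∗ S) ·ₚ ẑ) ((W ∗ S) ·ₚ ẑ))
           (((U ∗ V) ∗ Z) ·ₚ (x̂ ⊙ₚ ŷ)) (((U ∗ Y) ∗ S) ·ₚ (x̂ ⊙ₚ ẑ)) (((X ∗ V) ∗ S) ·ₚ (ŷ ⊙ₚ ẑ))
           (((U ∗ V) ∗ S) ·ₚ ((x̂ ⊙ₚ ŷ) ⊙ₚ ẑ))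
      ≈⟨ Σ₇-cong ≋-refl ≋-refl ẑ-terms ≋-refl ≋-refl ≋-refl ≋-refl ⟩
        expansion (λ p q s → (p ∗ q) ∗ s) ((x̂ ⊙ₚ ŷ) ⊙ₚ ẑ) ∎
      where
      T₁ T₂ W : Poly
      T₁ = (U ∗ Y) ·ₚ x̂
      T₂ = (X ∗ V) ·ₚ ŷ
      W  = (U ∗ V) ·ₚ (x̂ ⊙ₚ ŷ)
      ẑ-terms : Σ₃ ((T₁ ∗ S) ·ₚ ẑ) ((T₂ ∗ S) ·ₚ ẑ) ((W ∗ S) ·ₚ ẑ) ≋ ((X ∗ Y) ∗ S) ·ₚ ẑ
      ẑ-terms = ≋-sym (≋-trans (·ₚ-cong (≋-trans (∗-cong (∗-·ₚ-expand U V x̂ ŷ lx ly) (≋-refl {S})) (∗-Σ₃ˡ T₁ T₂ W S))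
                                        (≋-refl {ẑ}))
                               (·ₚ-Σ₃ˡ (T₁ ∗ S) (T₂ ∗ S) (W ∗ S) ẑ))

    expandʳ : X ∗ (Y ∗ Z) ≋ expansion (λ p q s → p ∗ (q ∗ s)) (x̂ ⊙ₚ (ŷ ⊙ₚ ẑ))
    expandʳ = begin
        X ∗ (Y ∗ Z)
      ≈⟨ ∗-cong (≋-refl {X}) (∗-·ₚ-expand V S ŷ ẑ ly lz) ⟩
        X ∗ Σ₃ E₁ E₂ E₃
      ≈⟨ ∗-Σ₃ʳ X E₁ E₂ E₃ ⟩
        Σ₃ (X ∗ E₁) (X ∗ E₂) (X ∗ E₃)
      ≈⟨ Σ₃-cong (∗-·ₚ-expand U (V ∗ Z) x̂ ŷ lx ly) (∗-·ₚ-expand U (Y ∗ S) x̂ ẑ lx lz)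
                 (∗-·ₚ-expand U (V ∗ S) x̂ (ŷ ⊙ₚ ẑ) lx (⊙ₚ-letterComb ŷ ẑ)) ⟩
        Σ₃ (Σ₃ ((U ∗ E₁) ·ₚ x̂) ((X ∗ (V ∗ Z)) ·ₚ ŷ) ((U ∗ (V ∗ Z)) ·ₚ (x̂ ⊙ₚ ŷ)))
           (Σ₃ ((U ∗ E₂) ·ₚ x̂) ((X ∗ (Y ∗ S)) ·ₚ ẑ) ((U ∗ (Y ∗ S)) ·ₚ (x̂ ⊙ₚ ẑ)))
           (Σ₃ ((U ∗ E₃) ·ₚ x̂) ((X ∗ (V ∗ S)) ·ₚ (ŷ ⊙ₚ ẑ)) ((U ∗ (V ∗ S)) ·ₚ (x̂ ⊙ₚ (ŷ ⊙ₚ ẑ))))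
      ≈⟨ Σ₃Σ₃-regroupʳ ((U ∗ E₁) ·ₚ x̂) ((X ∗ (V ∗ Z)) ·ₚ ŷ) ((U ∗ (V ∗ Z)) ·ₚ (x̂ ⊙ₚ ŷ))
                       ((U ∗ E₂) ·ₚ x̂) ((X ∗ (Y ∗ S)) ·ₚ ẑ) ((U ∗ (Y ∗ S)) ·ₚ (x̂ ⊙ₚ ẑ))
                       ((U ∗ E₃) ·ₚ x̂) ((X ∗ (V ∗ S)) ·ₚ (ŷ ⊙ₚ ẑ)) ((U ∗ (V ∗ S)) ·ₚ (x̂ ⊙ₚ (ŷ ⊙ₚ ẑ))) ⟩
        Σ₇ (Σ₃ ((U ∗ E₁) ·ₚ x̂) ((U ∗ E₂) ·ₚ x̂) ((U ∗ E₃) ·ₚ x̂))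
           ((X ∗ (V ∗ Z)) ·ₚ ŷ) ((X ∗ (Y ∗ S)) ·ₚ ẑ) ((U ∗ (V ∗ Z)) ·ₚ (x̂ ⊙ₚ ŷ)) ((U ∗ (Y ∗ S)) ·ₚ (x̂ ⊙ₚ ẑ))
           ((X ∗ (V ∗ S)) ·ₚ (ŷ ⊙ₚ ẑ)) ((U ∗ (V ∗ S)) ·ₚ (x̂ ⊙ₚ (ŷ ⊙ₚ ẑ)))
      ≈⟨ Σ₇-cong x̂-terms ≋-refl ≋-refl ≋-refl ≋-refl ≋-refl ≋-refl ⟩
        expansion (λ p q s → p ∗ (q ∗ s)) (x̂ ⊙ₚ (ŷ ⊙ₚ ẑ)) ∎
      where
      E₁ E₂ E₃ : Poly
      E₁ = (V ∗ Z) ·ₚ ŷ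
      E₂ = (Y ∗ S) ·ₚ ẑ
      E₃ = (V ∗ S) ·ₚ (ŷ ⊙ₚ ẑ)
      x̂-terms : Σ₃ ((U ∗ E₁) ·ₚ x̂) ((U ∗ E₂) ·ₚ x̂) ((U ∗ E₃) ·ₚ x̂) ≋ (U ∗ (Y ∗ Z)) ·ₚ x̂
      x̂-terms = ≋-sym (≋-trans (·ₚ-cong (≋-trans (∗-cong (≋-refl {U}) (∗-·ₚ-expand V S ŷ ẑ ly lz)) (∗-Σ₃ʳ U E₁ E₂ E₃))
                                        (≋-refl {x̂}))
                               (·ₚ-Σ₃ˡ (U ∗ E₁) (U ∗ E₂) (U ∗ E₃) x̂))


    assoc-step : (⊙ₚ-assoc : (x̂ ⊙ₚ ŷ) ⊙ₚ ẑ ≋ x̂ ⊙ₚ (ŷ ⊙ₚ ẑ)) →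
                 Assoc U Y Z → Assoc X V Z → Assoc X Y S → Assoc U V Z → Assoc U Y S → Assoc X V S → Assoc U V S →
                 Assoc X Y Z
    assoc-step ⊙ₚ-assoc h₁ h₂ h₃ h₄ h₅ h₆ h₇ = begin
        (X ∗ Y) ∗ Z
      ≈⟨ expandˡ ⟩
        expansion (λ p q s → (p ∗ q) ∗ s) ((x̂ ⊙ₚ ŷ) ⊙ₚ ẑ)
      ≈⟨ Σ₇-cong (·ₚ-cong h₁ (≋-refl {x̂})) (·ₚ-cong h₂ (≋-refl {ŷ})) (·ₚ-cong h₃ (≋-refl {ẑ}))
                 (·ₚ-cong h₄ (≋-refl {x̂ ⊙ₚ ŷ})) (·ₚ-cong h₅ (≋-refl {x̂ ⊙ₚ ẑ})) (·ₚ-cong h₆ (≋-refl {ŷ ⊙ₚ ẑ}))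
                 (·ₚ-cong h₇ ⊙ₚ-assoc) ⟩
        expansion (λ p q s → p ∗ (q ∗ s)) (x̂ ⊙ₚ (ŷ ⊙ₚ ẑ))
      ≈⟨ expandʳ ⟨
        X ∗ (Y ∗ Z) ∎

  module _ (⊙-assoc : ∀ a b c → (a ⊙ b) ⊙ₚ ⌜ c ⌝ˡ ≋ ⌜ a ⌝ˡ ⊙ₚ (b ⊙ c)) where

    ⊙ₚ-assoc-letters : ∀ a b c → (⌜ a ⌝ˡ ⊙ₚ ⌜ b ⌝ˡ) ⊙ₚ ⌜ c ⌝ˡ ≋ ⌜ a ⌝ˡ ⊙ₚ (⌜ b ⌝ˡ ⊙ₚ ⌜ c ⌝ˡ)
    ⊙ₚ-assoc-letters a b c = begin
      (⌜ a ⌝ˡ ⊙ₚ ⌜ b ⌝ˡ) ⊙ₚ ⌜ c ⌝ˡ   ≈⟨ ⊙ₚ-cong (⌜⌝ˡ⊙ₚ⌜⌝ˡ a b) (≋-refl {⌜ c ⌝ˡ}) ⟩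
      (a ⊙ b) ⊙ₚ ⌜ c ⌝ˡ             ≈⟨ ⊙-assoc a b c ⟩
      ⌜ a ⌝ˡ ⊙ₚ (b ⊙ c)             ≈⟨ ⊙ₚ-cong (≋-refl {⌜ a ⌝ˡ}) (⌜⌝ˡ⊙ₚ⌜⌝ˡ b c) ⟨
      ⌜ a ⌝ˡ ⊙ₚ (⌜ b ⌝ˡ ⊙ₚ ⌜ c ⌝ˡ)   ∎

    ∗-assoc-basis : ∀ u v w → Assoc ⌜ u ⌝ ⌜ v ⌝ ⌜ w ⌝
    ∗-assoc-basis []      v       w       =
      ≋-trans (∗-cong (∗-identityˡ ⌜ v ⌝) (≋-refl {⌜ w ⌝})) (≋-sym (∗-identityˡ (⌜ v ⌝ ∗ ⌜ w ⌝)))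
    ∗-assoc-basis (u ▸ x) []      w       =
      ≋-trans (∗-cong (∗-identityʳ ⌜ u ▸ x ⌝) (≋-refl {⌜ w ⌝})) (∗-cong (≋-refl {⌜ u ▸ x ⌝}) (≋-sym (∗-identityˡ ⌜ w ⌝)))
    ∗-assoc-basis (u ▸ x) (v ▸ y) []      =
      ≋-trans (∗-identityʳ (⌜ u ▸ x ⌝ ∗ ⌜ v ▸ y ⌝)) (∗-cong (≋-refl {⌜ u ▸ x ⌝}) (≋-sym (∗-identityʳ ⌜ v ▸ y ⌝)))
    ∗-assoc-basis (u ▸ x) (v ▸ y) (w ▸ z) =
      Assoc-resp (≋-sym e_x) (≋-sym e_y) (≋-sym e_z)
        (Expansion.assoc-step ⌜ u ⌝ ⌜ v ⌝ ⌜ w ⌝ x y z (⊙ₚ-assoc-letters x y z)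
          (Assoc-resp (≋-refl {⌜ u ⌝}) e_y e_z (∗-assoc-basis u (v ▸ y) (w ▸ z)))
          (Assoc-resp e_x (≋-refl {⌜ v ⌝}) e_z (∗-assoc-basis (u ▸ x) v (w ▸ z)))
          (Assoc-resp e_x e_y (≋-refl {⌜ w ⌝}) (∗-assoc-basis (u ▸ x) (v ▸ y) w))
          (Assoc-resp (≋-refl {⌜ u ⌝}) (≋-refl {⌜ v ⌝}) e_z (∗-assoc-basis u v (w ▸ z)))
          (Assoc-resp (≋-refl {⌜ u ⌝}) e_y (≋-refl {⌜ w ⌝}) (∗-assoc-basis u (v ▸ y) w))
          (Assoc-resp e_x (≋-refl {⌜ v ⌝}) (≋-refl {⌜ w ⌝}) (∗-assoc-basis (u ▸ x) v w))
          (∗-assoc-basis u v w))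
      where
      e_x : ⌜ u ▸ x ⌝ ≋ ⌜ u ⌝ ·ₚ ⌜ x ⌝ˡ
      e_y : ⌜ v ▸ y ⌝ ≋ ⌜ v ⌝ ·ₚ ⌜ y ⌝ˡ
      e_z : ⌜ w ▸ z ⌝ ≋ ⌜ w ⌝ ·ₚ ⌜ z ⌝ˡ
      e_x = ⌜▸⌝≋⌜⌝·ₚ⌜⌝ˡ u x
      e_y = ⌜▸⌝≋⌜⌝·ₚ⌜⌝ˡ v y
      e_z = ⌜▸⌝≋⌜⌝·ₚ⌜⌝ˡ w z

    ∗-assoc : ∀ p q s → (p ∗ q) ∗ s ≋ p ∗ (q ∗ s)
    ∗-assoc p q s = by-eval λ f →
      R.trans (eval-[∗]∗ p q s f)
              (R.trans (eval-cong p λ u → eval-cong q λ v → eval-cong s λ w → eval-≈ (∗-assoc-basis u v w) f)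
                       (R.sym (eval-∗[∗] p q s f)))

module FiniteDifferences (h : ℚ) where
  open import Data.Rational.Base using (0ℚ; _+_; _*_; _-_)
  open import Data.Rational.Solver using (module +-*-Solver)
  open +-*-Solver
  open import Data.Nat.Base as ℕ using (z≤n; s≤s; _⊔_)
  open import Relation.Binary.PropositionalEquality

  Δ : (ℚ → ℚ) → ℚ → ℚ
  Δ f x = f (x + h) - f x

  Degree≤ : ℕ → (ℚ → ℚ) → Set
  Degree≤ zero    f = ∀ x → f (x + h) ≡ f x
  Degree≤ (suc d) f = Degree≤ d (Δ f)

  Degree≤-cong : ∀ d {f g} → (∀ x → f x ≡ g x) → Degree≤ d f → Degree≤ d g
  Degree≤-cong zero    f≗g D x = trans (sym (f≗g (x + h))) (trans (D x) (f≗g x))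
  Degree≤-cong (suc d) f≗g D = Degree≤-cong d (λ x → cong₂ _-_ (f≗g (x + h)) (f≗g x)) D

  Degree≤-const : ∀ d a → Degree≤ d (λ _ → a)
  Degree≤-const zero    a x = refl
  Degree≤-const (suc d) a = Degree≤-cong d (λ _ → sym (ℚP.+-inverseʳ a)) (Degree≤-const d 0ℚ)

  Degree≤-+ : ∀ d {f g} → Degree≤ d f → Degree≤ d g → Degree≤ d (λ x → f x + g x)
  Degree≤-+ zero    Df Dg x = cong₂ _+_ (Df x) (Dg x)
  Degree≤-+ (suc d) {f} {g} Df Dg =
    Degree≤-cong d (λ x → Δ-+ (f (x + h)) (f x) (g (x + h)) (g x)) (Degree≤-+ d Df Dg)
    where Δ-+ : ∀ a b c e → (a - b) + (c - e) ≡ (a + c) - (b + e)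
          Δ-+ = solve 4 (λ a b c e → (a :- b) :+ (c :- e) := (a :+ c) :- (b :+ e)) refl

  Degree≤-* : ∀ d a {f} → Degree≤ d f → Degree≤ d (λ x → a * f x)
  Degree≤-* zero    a Df x = cong (a *_) (Df x)
  Degree≤-* (suc d) a {f} Df = Degree≤-cong d (λ x → Δ-* a (f (x + h)) (f x)) (Degree≤-* d a Df)
    where Δ-* : ∀ a b c → a * (b - c) ≡ a * b - a * c
          Δ-* = solve 3 (λ a b c → a :* (b :- c) := a :* b :- a :* c) refl

  Degree≤-shift : ∀ d {f} → Degree≤ d f → Degree≤ d (λ x → f (x + h))
  Degree≤-shift zero    Df x = Df (x + h)
  Degree≤-shift (suc d) Df = Degree≤-shift d Df

  Degree≤-suc : ∀ d {f} → Degree≤ d f → Degree≤ (suc d) f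
  Degree≤-suc zero    {f} Df =
    Degree≤-cong zero (λ x → trans (sym (ℚP.+-inverseʳ (f x))) (cong (_- f x) (sym (Df x)))) (Degree≤-const zero 0ℚ)
  Degree≤-suc (suc d) Df = Degree≤-suc d Df

  Degree≤-mono : ∀ {d e} f → d ℕ.≤ e → Degree≤ d f → Degree≤ e f
  Degree≤-mono {e = zero}  f z≤n       Df = Df
  Degree≤-mono {e = suc e} f z≤n       Df = Degree≤-suc e {f} (Degree≤-mono {e = e} f z≤n Df)
  Degree≤-mono             f (s≤s d≤e) Df = Degree≤-mono (Δ f) d≤e Df

  -- Δ((x + a) f) = (x + a) Δf + h f(x + h): a discrete product rule.
  Degree≤-linear* : ∀ d a {f} → Degree≤ d f → Degree≤ (suc d) (λ x → (x + a) * f x)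
  Degree≤-linear* d a {f} Df =
    Degree≤-cong d (λ x → product-rule x a h (f (x + h)) (f x))
                   (Degree≤-+ d (linear*Δ d Df) (Degree≤-* d h (Degree≤-shift d Df)))
    where
    product-rule : ∀ x a e b c → (x + a) * (b - c) + e * b ≡ ((x + e) + a) * b - (x + a) * c
    product-rule = solve 5 (λ x a h b c → (x :+ a) :* (b :- c) :+ h :* b := ((x :+ h) :+ a) :* b :- (x :+ a) :* c) refl
    linear*Δ : ∀ d {f} → Degree≤ d f → Degree≤ d (λ x → (x + a) * Δ f x)
    linear*Δ zero    {f} Df = Degree≤-cong zero
      (λ x → sym (trans (cong (λ t → (x + a) * (t - f x)) (Df x))
                        (trans (cong ((x + a) *_) (ℚP.+-inverseʳ (f x))) (ℚP.*-zeroʳ (x + a)))))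
      (Degree≤-const zero 0ℚ)
    linear*Δ (suc d) Df = Degree≤-linear* d a Df

  IsPolynomial : (ℚ → ℚ) → Set
  IsPolynomial f = Σ ℕ (λ d → Degree≤ d f)

  IsPolynomial-cong : ∀ {f g} → (∀ x → f x ≡ g x) → IsPolynomial f → IsPolynomial g
  IsPolynomial-cong f≗g (d , Df) = d , Degree≤-cong d f≗g Df

  IsPolynomial-const : ∀ a → IsPolynomial (λ _ → a)
  IsPolynomial-const a = 0 , Degree≤-const 0 a

  IsPolynomial-+ : ∀ {f g} → IsPolynomial f → IsPolynomial g → IsPolynomial (λ x → f x + g x)
  IsPolynomial-+ {f} {g} (d , Df) (e , Dg) =
    d ⊔ e , Degree≤-+ (d ⊔ e) (Degree≤-mono f (ℕP.m≤m⊔n d e) Df) (Degree≤-mono g (ℕP.m≤n⊔m d e) Dg)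

  IsPolynomial-* : ∀ a {f} → IsPolynomial f → IsPolynomial (λ x → a * f x)
  IsPolynomial-* a (d , Df) = d , Degree≤-* d a Df

  IsPolynomial-linear* : ∀ a {f} → IsPolynomial f → IsPolynomial (λ x → (x + a) * f x)
  IsPolynomial-linear* a (d , Df) = suc d , Degree≤-linear* d a Df

  IsPolynomial-^* : ∀ a n {f} → IsPolynomial f → IsPolynomial (λ x → (x + a) ^ℚ n * f x)
  IsPolynomial-^* a zero    {f} Pf = IsPolynomial-cong (λ x → sym (ℚP.*-identityˡ (f x))) Pf
  IsPolynomial-^* a (suc n) {f} Pf =
    IsPolynomial-cong (λ x → sym (ℚP.*-assoc (x + a) ((x + a) ^ℚ n) (f x))) (IsPolynomial-linear* a (IsPolynomial-^* a n Pf))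

  _+[1+_]h : ℚ → ℕ → ℚ
  a +[1+ zero  ]h = a + h
  a +[1+ suc j ]h = (a +[1+ j ]h) + h

  Degree≤-root : ∀ d {f} a → Degree≤ d f → (∀ j → j ℕ.≤ d → f (a +[1+ j ]h) ≡ 0ℚ) → f a ≡ 0ℚ
  Degree≤-root zero    a Df roots = trans (sym (Df a)) (roots 0 z≤n)
  Degree≤-root (suc d) {f} a Df roots = trans (b≡a-[a-b] (f (a + h)) (f a)) (cong₂ _-_ (roots 0 z≤n) Δf[a]≡0)
    where
    b≡a-[a-b] : ∀ a b → b ≡ a - (a - b)
    b≡a-[a-b] = solve 2 (λ a b → b := a :- (a :- b)) refl
    Δf[a]≡0 : Δ f a ≡ 0ℚ
    Δf[a]≡0 = Degree≤-root d a Df λ j j≤d →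
      cong₂ _-_ (roots (suc j) (s≤s j≤d)) (roots j (ℕP.m≤n⇒m≤1+n j≤d))

module PartialFractionUniqueness where
  open import Data.Rational.Base as ℚ using (0ℚ; 1ℚ; _+_; _*_; -_; 1/_; _≤_; Positive)
  open import Data.Rational.Solver using (module +-*-Solver)
  open +-*-Solver
  open import Data.Nat.Base as ℕ using (s≤s; _∸_)
  open import Data.List.Base using (filter; length)
  open import Data.List.Extrema.Nat using (argmax; argmax-all; f[xs]≤f[argmax])
  open import Data.List.Relation.Unary.All.Properties using (all-filter)
  open import Data.List.Membership.Propositional.Properties using (∈-filter⁺; ∈-filter⁻)
  import Data.List.Relation.Unary.Unique.Propositional.Properties as Unique
  import Data.List.Relation.Unary.Any as Any
  open import Data.List.Properties using (filter-all; filter-accept; filter-reject; filter-notAll)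
  open import Relation.Nullary using (¬?; Dec)
  open import Relation.Nullary.Decidable using (recompute)
  open import Relation.Binary.PropositionalEquality
  open Sums ℚP.+-*-commutativeRing using (∑)

  -- Letters store positivity irrelevantly; being decidable, it can be recomputed.
  recoverPositive : ∀ q → .(Positive q) → Positive q
  recoverPositive q pos = ℚ.positive (recompute (0ℚ ℚP.<? q) (ℚP.positive⁻¹ q {{pos}}))

  *≡0⇒≡0 : ∀ a b → b ≢ 0ℚ → a * b ≡ 0ℚ → a ≡ 0ℚ
  *≡0⇒≡0 a b b≢0 ab≡0 = begin
      a                  ≡⟨ ℚP.*-identityʳ a ⟨
      a * 1ℚ             ≡⟨ cong (a *_) (ℚP.*-inverseʳ b) ⟨
      a * (b * 1/ b)     ≡⟨ ℚP.*-assoc a b (1/ b) ⟨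
      (a * b) * 1/ b     ≡⟨ cong (_* 1/ b) ab≡0 ⟩
      0ℚ * 1/ b          ≡⟨ ℚP.*-zeroˡ (1/ b) ⟩
      0ℚ                 ∎
    where open ≡-Reasoning
          instance b-nonZero : ℚ.NonZero b
                   b-nonZero = ℚ.≢-nonZero b≢0

  *-≢0 : ∀ {a b} → a ≢ 0ℚ → b ≢ 0ℚ → a * b ≢ 0ℚ
  *-≢0 {a} {b} a≢0 b≢0 ab≡0 = a≢0 (*≡0⇒≡0 a b b≢0 ab≡0)

  ^-≢0 : ∀ {a} n → a ≢ 0ℚ → a ^ℚ n ≢ 0ℚ
  ^-≢0 zero    a≢0 ()
  ^-≢0 (suc n) a≢0 = *-≢0 a≢0 (^-≢0 n a≢0)

  0^suc : ∀ n → 0ℚ ^ℚ suc n ≡ 0ℚ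
  0^suc n = ℚP.*-zeroˡ (0ℚ ^ℚ n)

  ^-+ : ∀ q a b → q ^ℚ (a ℕ.+ b) ≡ q ^ℚ a * q ^ℚ b
  ^-+ q zero    b = sym (ℚP.*-identityˡ _)
  ^-+ q (suc a) b = trans (cong (q *_) (^-+ q a b)) (sym (ℚP.*-assoc q _ _))

  ^-pos : ∀ q n → .{{Positive q}} → Positive (q ^ℚ n)
  ^-pos q zero    = _
  ^-pos q (suc n) = ℚP.pos*pos⇒pos q (q ^ℚ n) {{^-pos q n}}

  base-pos : ∀ x q → .(0ℚ ≤ x) → .(Positive q) → Positive (x + q)
  base-pos x q 0≤x pos = ℚP.nonNeg+pos⇒pos x {{ℚ.nonNegative 0≤x}} q {{pos}}

  power-nonZero : ∀ x q n → .(0ℚ ≤ x) → .(Positive q) → ℚ.NonZero ((x + q) ^ℚ n)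
  power-nonZero x q n 0≤x pos = ℚP.pos⇒nonZero ((x + q) ^ℚ n) {{^-pos (x + q) n {{base-pos x q 0≤x pos}}}}

  val : (x : ℚ) → .(0ℚ ≤ x) → Letter → ℚ
  val x 0≤x (letter k q pos) = 1/ ((x + q) ^ℚ suc k)
    where instance denominator-nonZero : ℚ.NonZero ((x + q) ^ℚ suc k)
                   denominator-nonZero = power-nonZero x q (suc k) 0≤x pos

  val-inverse : ∀ x .(0≤x : 0ℚ ≤ x) l → (x + Letter.m l) ^ℚ kOf l * val x 0≤x l ≡ 1ℚ
  val-inverse x 0≤x (letter k q pos) = ℚP.*-inverseʳ ((x + q) ^ℚ suc k)
    where instance denominator-nonZero : ℚ.NonZero ((x + q) ^ℚ suc k)
                   denominator-nonZero = power-nonZero x q (suc k) 0≤x pos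

  polynomial-root : ∀ p → Positive p → ∀ {f} → FiniteDifferences.IsPolynomial p f →
                    (∀ x → .(0ℚ ≤ x) → f x ≡ 0ℚ) → f (- p) ≡ 0ℚ
  polynomial-root p pos (d , Df) vanishes = Degree≤-root d (- p) Df (λ j _ → vanishes _ (nonNeg j))
    where
    open FiniteDifferences p using (Degree≤-root; _+[1+_]h)
    nonNeg : ∀ j → 0ℚ ≤ (- p) +[1+ j ]h
    nonNeg zero    = ℚP.≤-reflexive (sym (ℚP.+-inverseˡ p))
    nonNeg (suc j) = ℚP.+-mono-≤ (nonNeg j) (ℚP.<⇒≤ (ℚP.positive⁻¹ p {{pos}}))

  Letter-≡ : ∀ {l l′} → pk l ≡ pk l′ → Letter.m l ≡ Letter.m l′ → l ≡ l′
  Letter-≡ {letter _ _ _} {letter _ _ _} refl refl = refl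

  VanishesOn : (Letter → ℚ) → List Letter → Set
  VanishesOn c L = ∀ x → .(0≤x : 0ℚ ≤ x) → ∑ L (λ l → c l * val x 0≤x l) ≡ 0ℚ

  -- Multiplying by (x + p)^K ∏_{m_l ≠ p} (x + m_l)^{k_l}, where l★ = y_{K,p} has maximal index among the
  -- letters with parameter p, turns ∑ c_l/(x + m_l)^{k_l} into a polynomial whose value at -p is
  -- c_{l★} ∏_{m_l ≠ p} (m_l - p)^{k_l}.
  module ClearingDenominators (c : Letter → ℚ) (l★ : Letter) where
    open FiniteDifferences (Letter.m l★)
      using (IsPolynomial; IsPolynomial-const; IsPolynomial-+; IsPolynomial-*; IsPolynomial-^*; IsPolynomial-cong)

    p : ℚ
    p = Letter.m l★
    K : ℕ
    K = kOf l★

    denominatorFactor : Letter → ℚ → ℚ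
    denominatorFactor l x with Letter.m l ℚP.≟ p
    ... | yes _ = 1ℚ
    ... | no  _ = (x + Letter.m l) ^ℚ kOf l

    clearedPower : Letter → ℚ → ℚ
    clearedPower l x with Letter.m l ℚP.≟ p
    ... | yes _ = (x + p) ^ℚ (K ∸ kOf l)
    ... | no  _ = (x + p) ^ℚ K

    denominator : List Letter → ℚ → ℚ
    denominator []      x = 1ℚ
    denominator (l ∷ L) x = denominatorFactor l x * denominator L x

    clearedSum : List Letter → ℚ → ℚ
    clearedSum []      x = 0ℚ
    clearedSum (l ∷ L) x = c l * (clearedPower l x * denominator L x) + denominatorFactor l x * clearedSum L x

    Bounded : Letter → Set
    Bounded l = Letter.m l ≡ p → kOf l ℕ.≤ K

    clearedPower-val : ∀ x .(0≤x : 0ℚ ≤ x) l → Bounded l →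
                       (x + p) ^ℚ K * denominatorFactor l x * val x 0≤x l ≡ clearedPower l x
    clearedPower-val x 0≤x l bounded with Letter.m l ℚP.≟ p
    ... | yes m≡p = begin
        (x + p) ^ℚ K * 1ℚ * v                                 ≡⟨ cong (_* v) (ℚP.*-identityʳ ((x + p) ^ℚ K)) ⟩
        (x + p) ^ℚ K * v                                      ≡⟨ cong (λ n → (x + p) ^ℚ n * v) (ℕP.m∸n+n≡m (bounded m≡p)) ⟨
        (x + p) ^ℚ ((K ∸ kOf l) ℕ.+ kOf l) * v                ≡⟨ cong (_* v) (^-+ (x + p) (K ∸ kOf l) (kOf l)) ⟩
        (x + p) ^ℚ (K ∸ kOf l) * (x + p) ^ℚ kOf l * v         ≡⟨ ℚP.*-assoc ((x + p) ^ℚ (K ∸ kOf l)) ((x + p) ^ℚ kOf l) v ⟩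
        (x + p) ^ℚ (K ∸ kOf l) * ((x + p) ^ℚ kOf l * v)       ≡⟨ cong (λ q → (x + p) ^ℚ (K ∸ kOf l) * ((x + q) ^ℚ kOf l * v)) m≡p ⟨
        (x + p) ^ℚ (K ∸ kOf l) * ((x + Letter.m l) ^ℚ kOf l * v) ≡⟨ cong ((x + p) ^ℚ (K ∸ kOf l) *_) (val-inverse x 0≤x l) ⟩
        (x + p) ^ℚ (K ∸ kOf l) * 1ℚ                           ≡⟨ ℚP.*-identityʳ _ ⟩
        (x + p) ^ℚ (K ∸ kOf l)                                ∎
      where open ≡-Reasoning
            v : ℚ
            v = val x 0≤x l
    ... | no  _ = trans (ℚP.*-assoc ((x + p) ^ℚ K) _ (val x 0≤x l))
                        (trans (cong ((x + p) ^ℚ K *_) (val-inverse x 0≤x l)) (ℚP.*-identityʳ ((x + p) ^ℚ K)))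

    clearedSum≡ : ∀ L → All Bounded L → ∀ x .(0≤x : 0ℚ ≤ x) →
                  clearedSum L x ≡ (x + p) ^ℚ K * denominator L x * ∑ L (λ l → c l * val x 0≤x l)
    clearedSum≡ []      []         x 0≤x = sym (ℚP.*-zeroʳ ((x + p) ^ℚ K * 1ℚ))
    clearedSum≡ (l ∷ L) (bl ∷ bL) x 0≤x = begin
        c l * (clearedPower l x * denominator L x) + denominatorFactor l x * clearedSum L x
      ≡⟨ cong₂ (λ a b → c l * (a * denominator L x) + denominatorFactor l x * b)
               (sym (clearedPower-val x 0≤x l bl)) (clearedSum≡ L bL x 0≤x) ⟩
        c l * ((x + p) ^ℚ K * denominatorFactor l x * val x 0≤x l * denominator L x)
          + denominatorFactor l x * ((x + p) ^ℚ K * denominator L x * ∑ L (λ l → c l * val x 0≤x l))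
      ≡⟨ regroup (c l) ((x + p) ^ℚ K) (denominatorFactor l x) (val x 0≤x l) (denominator L x) _ ⟩
        (x + p) ^ℚ K * (denominatorFactor l x * denominator L x) * (c l * val x 0≤x l + ∑ L (λ l → c l * val x 0≤x l)) ∎
      where open ≡-Reasoning
            regroup : ∀ c e f v d s → c * (e * f * v * d) + f * (e * d * s) ≡ e * (f * d) * (c * v + s)
            regroup = solve 6 (λ c e f v d s → c :* (e :* f :* v :* d) :+ f :* (e :* d :* s) := e :* (f :* d) :* (c :* v :+ s)) refl

    denominatorFactor-polynomial : ∀ l {f} → IsPolynomial f → IsPolynomial (λ x → denominatorFactor l x * f x)
    denominatorFactor-polynomial l {f} Pf with Letter.m l ℚP.≟ p
    ... | yes _ = IsPolynomial-cong (λ x → sym (ℚP.*-identityˡ (f x))) Pf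
    ... | no  _ = IsPolynomial-^* (Letter.m l) (kOf l) Pf

    clearedPower-polynomial : ∀ l {f} → IsPolynomial f → IsPolynomial (λ x → clearedPower l x * f x)
    clearedPower-polynomial l Pf with Letter.m l ℚP.≟ p
    ... | yes _ = IsPolynomial-^* p (K ∸ kOf l) Pf
    ... | no  _ = IsPolynomial-^* p K Pf

    denominator-polynomial : ∀ L → IsPolynomial (denominator L)
    denominator-polynomial []      = IsPolynomial-const 1ℚ
    denominator-polynomial (l ∷ L) = denominatorFactor-polynomial l (denominator-polynomial L)

    clearedSum-polynomial : ∀ L → IsPolynomial (clearedSum L)
    clearedSum-polynomial []      = IsPolynomial-const 0ℚ
    clearedSum-polynomial (l ∷ L) =
      IsPolynomial-+ (IsPolynomial-* (c l) (clearedPower-polynomial l (denominator-polynomial L)))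
                     (denominatorFactor-polynomial l (clearedSum-polynomial L))

    -p+p≡0 : - p + p ≡ 0ℚ
    -p+p≡0 = ℚP.+-inverseˡ p

    denominatorFactor-≢0 : ∀ l → denominatorFactor l (- p) ≢ 0ℚ
    denominatorFactor-≢0 l with Letter.m l ℚP.≟ p
    ... | yes _   = λ ()
    ... | no  m≢p = ^-≢0 (kOf l) λ -p+m≡0 → m≢p (trans (sym (+-cancel p (Letter.m l))) (trans (cong (p +_) -p+m≡0) (ℚP.+-identityʳ p)))
      where +-cancel : ∀ p q → p + (- p + q) ≡ q
            +-cancel = solve 2 (λ p q → p :+ (:- p :+ q) := q) refl

    denominator-≢0 : ∀ L → denominator L (- p) ≢ 0ℚ
    denominator-≢0 []      ()
    denominator-≢0 (l ∷ L) = *-≢0 (denominatorFactor-≢0 l) (denominator-≢0 L)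

    clearedPower-root : ∀ l → Bounded l → l ≢ l★ → clearedPower l (- p) ≡ 0ℚ
    clearedPower-root l bounded l≢l★ with Letter.m l ℚP.≟ p
    ... | no  _   = trans (cong (_^ℚ K) -p+p≡0) (0^suc (pk l★))
    ... | yes m≡p = trans (cong (_^ℚ (K ∸ kOf l)) -p+p≡0) (0^-pos (ℕP.m<n⇒0<n∸m k<K))
      where
      k<K : kOf l ℕ.< K
      k<K = ℕP.≤∧≢⇒< (bounded m≡p) (λ k≡K → l≢l★ (Letter-≡ (ℕP.suc-injective k≡K) m≡p))
      0^-pos : ∀ {n} → 0 ℕ.< n → 0ℚ ^ℚ n ≡ 0ℚ
      0^-pos {suc n} _ = 0^suc n

    clearedPower-l★ : clearedPower l★ (- p) ≡ 1ℚ
    clearedPower-l★ with Letter.m l★ ℚP.≟ p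
    ... | yes _   = cong ((- p + p) ^ℚ_) (ℕP.n∸n≡0 K)
    ... | no  p≢p = ⊥-elim (p≢p refl)

    clearedSum-∉ : ∀ L → l★ ∉ L → All Bounded L → clearedSum L (- p) ≡ 0ℚ
    clearedSum-∉ []      _    _          = refl
    clearedSum-∉ (l ∷ L) l★∉ (bl ∷ bL) =
      trans (cong₂ (λ a b → c l * (a * denominator L (- p)) + denominatorFactor l (- p) * b)
                   (clearedPower-root l bl (λ l≡l★ → l★∉ (here (sym l≡l★)))) (clearedSum-∉ L (λ m → l★∉ (there m)) bL))
            (zeros (c l) (denominator L (- p)) (denominatorFactor l (- p)))
      where zeros : ∀ a d b → a * (0ℚ * d) + b * 0ℚ ≡ 0ℚ
            zeros = solve 3 (λ a d b → a :* (con 0ℚ :* d) :+ b :* con 0ℚ := con 0ℚ) refl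

    clearedSum-root : ∀ L → l★ ∈ L → Unique L → All Bounded L → clearedSum L (- p) ≡ 0ℚ → c l★ ≡ 0ℚ
    clearedSum-root (l ∷ L) (here refl) (l∉ ∷ _) (_ ∷ bL) root =
      *≡0⇒≡0 (c l★) (denominator L (- p)) (denominator-≢0 L)
        (trans (sym (leading (c l★) (denominator L (- p)) (denominatorFactor l★ (- p))))
               (trans (cong₂ (λ a b → c l★ * (a * denominator L (- p)) + denominatorFactor l★ (- p) * b)
                             (sym clearedPower-l★) (sym (clearedSum-∉ L (λ m → All.lookup l∉ m refl) bL)))
                      root))
      where leading : ∀ a d b → a * (1ℚ * d) + b * 0ℚ ≡ a * d
            leading = solve 3 (λ a d b → a :* (con 1ℚ :* d) :+ b :* con 0ℚ := a :* d) refl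
    clearedSum-root (l ∷ L) (there l★∈) (l∉ ∷ uq) (bl ∷ bL) root =
      clearedSum-root L l★∈ uq bL
        (*≡0⇒≡0 (clearedSum L (- p)) (denominatorFactor l (- p)) (denominatorFactor-≢0 l)
          (trans (sym (tail (c l) (denominator L (- p)) (denominatorFactor l (- p)) (clearedSum L (- p))))
                 (trans (cong (λ a → c l * (a * denominator L (- p)) + denominatorFactor l (- p) * clearedSum L (- p))
                              (sym (clearedPower-root l bl λ { refl → All.lookup l∉ l★∈ refl })))
                        root)))
      where tail : ∀ a d b g → a * (0ℚ * d) + b * g ≡ g * b
            tail = solve 4 (λ a d b g → a :* (con 0ℚ :* d) :+ b :* g := g :* b) refl

    coefficient-vanishes : ∀ L → l★ ∈ L → Unique L → All Bounded L → VanishesOn c L → c l★ ≡ 0ℚ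
    coefficient-vanishes L l★∈ uq bL vanishes =
      clearedSum-root L l★∈ uq bL
        (polynomial-root p (positive-m l★) (clearedSum-polynomial L) λ x 0≤x →
          trans (clearedSum≡ L bL x 0≤x)
                (trans (cong ((x + p) ^ℚ K * denominator L x *_) (vanishes x 0≤x)) (ℚP.*-zeroʳ ((x + p) ^ℚ K * denominator L x))))
      where positive-m : ∀ l → Positive (Letter.m l)
            positive-m (letter _ q pos) = recoverPositive q pos

  open ClearingDenominators using (coefficient-vanishes)

  without : Letter → List Letter → List Letter
  without l = filter (λ l′ → ¬? (l′ ≟L l))

  ∑-without : ∀ {l} L (g : Letter → ℚ) → Unique L → l ∈ L → ∑ L g ≡ g l + ∑ (without l L) g
  ∑-without {l} (l′ ∷ L) g (l′∉ ∷ uq) l∈ = by-cases (l′ ≟L l)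
    where
    open ≡-Reasoning
    keep? : ∀ l′ → Dec (l′ ≢ l)
    keep? l′ = ¬? (l′ ≟L l)
    by-cases : Dec (l′ ≡ l) → ∑ (l′ ∷ L) g ≡ g l + ∑ (without l (l′ ∷ L)) g
    by-cases (yes refl) = begin
      g l + ∑ L g                                ≡⟨ cong (λ L → g l + ∑ L g) (filter-all keep? (All.map (λ l≢ l′≡l → l≢ (sym l′≡l)) l′∉)) ⟨
      g l + ∑ (without l L) g                    ≡⟨ cong (λ L → g l + ∑ L g) (filter-reject keep? (λ l≢l → l≢l refl)) ⟨
      g l + ∑ (without l (l ∷ L)) g              ∎
    by-cases (no l′≢l) = begin
      g l′ + ∑ L g                               ≡⟨ cong (g l′ +_) (∑-without L g uq (l∈L l∈)) ⟩
      g l′ + (g l + ∑ (without l L) g)           ≡⟨ solve 3 (λ a b s → a :+ (b :+ s) := b :+ (a :+ s)) refl (g l′) (g l) _ ⟩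
      g l + (g l′ + ∑ (without l L) g)           ≡⟨ cong (λ L → g l + ∑ L g) (filter-accept keep? l′≢l) ⟨
      g l + ∑ (without l (l′ ∷ L)) g             ∎
      where l∈L : l ∈ l′ ∷ L → l ∈ L
            l∈L (here l≡l′)  = ⊥-elim (l′≢l (sym l≡l′))
            l∈L (there l∈) = l∈

  partialFractions-independent : ∀ L → Unique L → ∀ c → VanishesOn c L → All (λ l → c l ≡ 0ℚ) L
  partialFractions-independent L = by-size (length L) L ℕP.≤-refl
    where
    by-size : ∀ n L → length L ℕ.≤ n → Unique L → ∀ c → VanishesOn c L → All (λ l → c l ≡ 0ℚ) L
    by-size _       []        _   _  _ _        = []
    by-size (suc n) L@(l₀ ∷ _) |L|≤ uq c vanishes = All.tabulate coefficient
      where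
      sameParameter : List Letter
      sameParameter = filter (λ l → Letter.m l ℚP.≟ Letter.m l₀) L
      l★ : Letter
      l★ = argmax pk l₀ sameParameter
      l★∈L : l★ ∈ L
      l★∈L = argmax-all pk {P = _∈ L} (here refl) (All.tabulate λ l∈ → proj₁ (∈-filter⁻ (λ l → Letter.m l ℚP.≟ Letter.m l₀) l∈))
      m★ : Letter.m l★ ≡ Letter.m l₀
      m★ = argmax-all pk {P = λ l → Letter.m l ≡ Letter.m l₀} refl (all-filter (λ l → Letter.m l ℚP.≟ Letter.m l₀) L)
      bounded : All (ClearingDenominators.Bounded c l★) L
      bounded = All.tabulate λ l∈ m≡ →
        s≤s (All.lookup (f[xs]≤f[argmax] l₀ sameParameter) (∈-filter⁺ (λ l → Letter.m l ℚP.≟ Letter.m l₀) l∈ (trans m≡ m★)))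
      c★ : c l★ ≡ 0ℚ
      c★ = coefficient-vanishes c l★ L l★∈L uq bounded vanishes
      rest-vanishes : VanishesOn c (without l★ L)
      rest-vanishes x 0≤x = begin
          ∑ (without l★ L) g                       ≡⟨ ℚP.+-identityˡ _ ⟨
          0ℚ + ∑ (without l★ L) g                  ≡⟨ cong (_+ ∑ (without l★ L) g) (trans (cong (_* val x 0≤x l★) c★) (ℚP.*-zeroˡ (val x 0≤x l★))) ⟨
          g l★ + ∑ (without l★ L) g                ≡⟨ ∑-without L g uq l★∈L ⟨
          ∑ L g                                    ≡⟨ vanishes x 0≤x ⟩
          0ℚ                                       ∎
        where open ≡-Reasoning
              g : Letter → ℚ
              g l = c l * val x 0≤x l
      |rest|≤ : length (without l★ L) ℕ.≤ n
      |rest|≤ = ℕP.≤-trans (ℕ.s≤s⁻¹ (filter-notAll (λ l′ → ¬? (l′ ≟L l★)) L (Any.map (λ l★≡ l≢ → l≢ (sym l★≡)) l★∈L)))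
                           (ℕ.s≤s⁻¹ |L|≤)
      rest-zero : All (λ l → c l ≡ 0ℚ) (without l★ L)
      rest-zero = by-size n (without l★ L) |rest|≤ (Unique.filter⁺ (λ l′ → ¬? (l′ ≟L l★)) uq) c rest-vanishes
      coefficient : ∀ {l} → l ∈ L → c l ≡ 0ℚ
      coefficient {l} l∈ with l ≟L l★
      ... | yes refl = c★
      ... | no  l≢l★ = All.lookup rest-zero (∈-filter⁺ (λ l′ → ¬? (l′ ≟L l★)) l∈ l≢l★)

module LetterProducts (A B : Coeffs) (PF : IsPartialFraction A B) where
  open import Data.Rational.Base as ℚ using (0ℚ; 1ℚ; _+_; _*_; _-_; -_; _≤_; Positive)
  open import Data.Rational.Solver using (module +-*-Solver)
  open +-*-Solver
  open import Data.Nat.Base as ℕ using (_∸_)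
  open import Data.List.Membership.DecPropositional _≟W_ using (_∈?_)
  open import Data.List.Membership.Propositional.Properties using (∈-map⁺; ∈-map⁻)
  import Data.List.Relation.Unary.Unique.Propositional.Properties as Unique
  open import Relation.Nullary using (Dec)
  open import Relation.Binary.PropositionalEquality
  open PartialFractionUniqueness
  open Sums ℚP.+-*-commutativeRing using (∑; ∑-map)
  -- ⊙ involves neither ι nor μ, so over ℚ we may take ι = id and μ = 0.
  open Stuffle ℚP.+-*-commutativeRing (λ q → q) 0ℚ A B
  open Evaluation ℚP.+-*-commutativeRing (λ q → q) 0ℚ A B

  valʷ : (x : ℚ) → .(0ℚ ≤ x) → Word → ℚ
  valʷ x 0≤x ([] ▸ a) = val x 0≤x a
  valʷ x 0≤x _        = 0ℚ

  inverse-unique : ∀ E y y′ → E ≢ 0ℚ → E * y ≡ 1ℚ → E * y′ ≡ 1ℚ → y ≡ y′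
  inverse-unique E y y′ E≢0 Ey≡1 Ey′≡1 =
    trans (sym (y-y′+y′ y y′))
          (trans (cong (_+ y′) (*≡0⇒≡0 (y - y′) E E≢0 (trans (factor y y′ E) (trans (cong₂ _-_ Ey≡1 Ey′≡1) (ℚP.+-inverseʳ 1ℚ)))))
                 (ℚP.+-identityˡ y′))
    where
    y-y′+y′ : ∀ y y′ → (y - y′) + y′ ≡ y
    y-y′+y′ = solve 2 (λ y y′ → (y :- y′) :+ y′ := y) refl
    factor : ∀ y y′ E → (y - y′) * E ≡ E * y - E * y′
    factor = solve 3 (λ y y′ E → (y :- y′) :* E := E :* y :- E :* y′) refl

  sum₁-*ˡ : ∀ E n g → E * sum₁ n g ≡ sum₁ n (λ i → E * g i)
  sum₁-*ˡ E zero    g = ℚP.*-zeroʳ E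
  sum₁-*ˡ E (suc n) g = trans (ℚP.*-distribˡ-+ E (sum₁ n g) (g (suc n))) (cong (_+ E * g (suc n)) (sum₁-*ˡ E n g))

  sum₁-cong : ∀ n {f g} → (∀ j → j ℕ.< n → f (suc j) ≡ g (suc j)) → sum₁ n f ≡ sum₁ n g
  sum₁-cong zero    f≗g = refl
  sum₁-cong (suc n) f≗g = cong₂ _+_ (sum₁-cong n (λ j j<n → f≗g j (ℕP.m<n⇒m<1+n j<n))) (f≗g n ℕP.≤-refl)

  eval-letters : ∀ x .(0≤x : 0ℚ ≤ x) n f q .(pos : Positive q) →
                 eval (letters n f q pos) (valʷ x 0≤x) ≡ sum₁ n (λ i → f i * val x 0≤x (letter (i ∸ 1) q pos))
  eval-letters x 0≤x zero    f q pos = refl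
  eval-letters x 0≤x (suc n) f q pos =
    trans (eval-++ (letters n f q pos) _ (valʷ x 0≤x)) (cong₂ _+_ (eval-letters x 0≤x n f q pos) (ℚP.+-identityʳ _))

  inverse-of-product : ∀ E₁ E₂ v₁ v₂ → E₁ * v₁ ≡ 1ℚ → E₂ * v₂ ≡ 1ℚ → (E₁ * E₂) * (v₁ * v₂) ≡ 1ℚ
  inverse-of-product E₁ E₂ v₁ v₂ e₁ e₂ =
    trans (solve 4 (λ a b c d → (a :* b) :* (c :* d) := (a :* c) :* (b :* d)) refl E₁ E₂ v₁ v₂)
          (trans (cong₂ _*_ e₁ e₂) (ℚP.*-identityˡ 1ℚ))

  power-≢0 : ∀ x .(0≤x : 0ℚ ≤ x) q .(pos : Positive q) n → (x + q) ^ℚ n ≢ 0ℚ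
  power-≢0 x 0≤x q pos n ≡0 =
    ℚP.<-irrefl (sym ≡0) (ℚP.positive⁻¹ _ {{^-pos (x + q) n {{base-pos x q 0≤x pos}}}})

  val-merge : ∀ x .(0≤x : 0ℚ ≤ x) k₁ k₂ m .(p₁ p₂ : Positive m) →
              val x 0≤x (letter (suc k₁ ℕ.+ k₂) m p₁) ≡ val x 0≤x (letter k₁ m p₁) * val x 0≤x (letter k₂ m p₂)
  val-merge x 0≤x k₁ k₂ m p₁ p₂ = inverse-unique E _ _ (*-≢0 (power-≢0 x 0≤x m p₁ (suc k₁)) (power-≢0 x 0≤x m p₂ (suc k₂)))
      (trans (cong (_* val x 0≤x (letter (suc k₁ ℕ.+ k₂) m p₁)) E≡) (val-inverse x 0≤x (letter (suc k₁ ℕ.+ k₂) m p₁)))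
      (inverse-of-product ((x + m) ^ℚ suc k₁) ((x + m) ^ℚ suc k₂) (val x 0≤x (letter k₁ m p₁)) (val x 0≤x (letter k₂ m p₂))
                          (val-inverse x 0≤x (letter k₁ m p₁)) (val-inverse x 0≤x (letter k₂ m p₂)))
    where
    E : ℚ
    E = (x + m) ^ℚ suc k₁ * (x + m) ^ℚ suc k₂
    E≡ : E ≡ (x + m) ^ℚ suc (suc k₁ ℕ.+ k₂)
    E≡ = trans (sym (^-+ (x + m) (suc k₁) (suc k₂))) (cong ((x + m) ^ℚ_) (cong suc (ℕP.+-suc k₁ k₂)))

  cancel-denominator : ∀ x .(0≤x : 0ℚ ≤ x) m .(p : Positive m) K j a → j ℕ.< K →
                       (x + m) ^ℚ K * (a * val x 0≤x (letter j m p)) ≡ a * (x + m) ^ℚ (K ∸ suc j)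
  cancel-denominator x 0≤x m p K j a j<K = begin
      (x + m) ^ℚ K * (a * v)      ≡⟨ cong (λ n → (x + m) ^ℚ n * (a * v)) (ℕP.m∸n+n≡m j<K) ⟨
      (x + m) ^ℚ (n ℕ.+ suc j) * (a * v)   ≡⟨ cong (_* (a * v)) (^-+ (x + m) n (suc j)) ⟩
      P * Q * (a * v)             ≡⟨ solve 4 (λ P Q a v → P :* Q :* (a :* v) := a :* P :* (Q :* v)) refl P Q a v ⟩
      a * P * (Q * v)             ≡⟨ cong (a * P *_) (val-inverse x 0≤x (letter j m p)) ⟩
      a * P * 1ℚ                  ≡⟨ ℚP.*-identityʳ (a * P) ⟩
      a * P                       ∎
    where open ≡-Reasoning
          n : ℕ
          n = K ∸ suc j
          v P Q : ℚ
          v = val x 0≤x (letter j m p)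
          P = (x + m) ^ℚ n
          Q = (x + m) ^ℚ suc j

  eval-partialFraction : ∀ x .(0≤x : 0ℚ ≤ x) k₁ m₁ .(p₁ : Positive m₁) k₂ m₂ .(p₂ : Positive m₂) → m₁ ≢ m₂ →
    eval (letters (suc k₁) (A (suc k₁) m₁ (suc k₂) m₂) m₁ p₁ ++ letters (suc k₂) (B (suc k₁) m₁ (suc k₂) m₂) m₂ p₂) (valʷ x 0≤x)
      ≡ val x 0≤x (letter k₁ m₁ p₁) * val x 0≤x (letter k₂ m₂ p₂)
  eval-partialFraction x 0≤x k₁ m₁ p₁ k₂ m₂ p₂ m₁≢m₂ = inverse-unique E _ _ (*-≢0 (power-≢0 x 0≤x m₁ p₁ K₁) (power-≢0 x 0≤x m₂ p₂ K₂))
      (begin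
        E * eval (letters K₁ Aₖ m₁ p₁ ++ letters K₂ Bₖ m₂ p₂) (valʷ x 0≤x)
      ≡⟨ cong (E *_) (trans (eval-++ (letters K₁ Aₖ m₁ p₁) _ (valʷ x 0≤x))
                            (cong₂ _+_ (eval-letters x 0≤x K₁ Aₖ m₁ p₁) (eval-letters x 0≤x K₂ Bₖ m₂ p₂))) ⟩
        E * (sum₁ K₁ (λ i → Aₖ i * val x 0≤x (letter (i ∸ 1) m₁ p₁)) + sum₁ K₂ (λ j → Bₖ j * val x 0≤x (letter (j ∸ 1) m₂ p₂)))
      ≡⟨ trans (ℚP.*-distribˡ-+ E _ _) (cong₂ _+_ (sum₁-*ˡ E K₁ _) (sum₁-*ˡ E K₂ _)) ⟩
        sum₁ K₁ (λ i → E * (Aₖ i * val x 0≤x (letter (i ∸ 1) m₁ p₁)))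
          + sum₁ K₂ (λ j → E * (Bₖ j * val x 0≤x (letter (j ∸ 1) m₂ p₂)))
      ≡⟨ cong₂ _+_ (sum₁-cong K₁ first) (sum₁-cong K₂ second) ⟩
        sum₁ K₁ (λ i → Aₖ i * (x + m₁) ^ℚ (K₁ ∸ i) * X₂) + sum₁ K₂ (λ j → Bₖ j * X₁ * (x + m₂) ^ℚ (K₂ ∸ j))
      ≡⟨ PF k₁ k₂ m₁ m₂ (recoverPositive m₁ p₁) (recoverPositive m₂ p₂) m₁≢m₂ x ⟨
        1ℚ ∎)
      (inverse-of-product X₁ X₂ (val x 0≤x (letter k₁ m₁ p₁)) (val x 0≤x (letter k₂ m₂ p₂))
                          (val-inverse x 0≤x (letter k₁ m₁ p₁)) (val-inverse x 0≤x (letter k₂ m₂ p₂)))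
    where
    open ≡-Reasoning
    K₁ K₂ : ℕ
    K₁ = suc k₁
    K₂ = suc k₂
    Aₖ Bₖ : ℕ → ℚ
    Aₖ = A K₁ m₁ K₂ m₂
    Bₖ = B K₁ m₁ K₂ m₂
    X₁ X₂ E : ℚ
    X₁ = (x + m₁) ^ℚ K₁
    X₂ = (x + m₂) ^ℚ K₂
    E = X₁ * X₂
    first : ∀ j → j ℕ.< K₁ → E * (Aₖ (suc j) * val x 0≤x (letter j m₁ p₁)) ≡ Aₖ (suc j) * (x + m₁) ^ℚ (K₁ ∸ suc j) * X₂
    first j j<K = trans (solve 3 (λ a b t → (a :* b) :* t := b :* (a :* t)) refl X₁ X₂ _)
                        (trans (cong (X₂ *_) (cancel-denominator x 0≤x m₁ p₁ K₁ j (Aₖ (suc j)) j<K))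
                               (ℚP.*-comm X₂ _))
    second : ∀ j → j ℕ.< K₂ → E * (Bₖ (suc j) * val x 0≤x (letter j m₂ p₂)) ≡ Bₖ (suc j) * X₁ * (x + m₂) ^ℚ (K₂ ∸ suc j)
    second j j<K = trans (ℚP.*-assoc X₁ X₂ _)
                         (trans (cong (X₁ *_) (cancel-denominator x 0≤x m₂ p₂ K₂ j (Bₖ (suc j)) j<K))
                                (solve 3 (λ a b c → a :* (b :* c) := b :* a :* c) refl X₁ (Bₖ (suc j)) _))

  ⊙-val : ∀ x .(0≤x : 0ℚ ≤ x) a b → eval (a ⊙ b) (valʷ x 0≤x) ≡ val x 0≤x a * val x 0≤x b
  ⊙-val x 0≤x (letter k₁ m₁ p₁) (letter k₂ m₂ p₂) with m₁ ℚP.≟ m₂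
  ... | yes refl   = trans (eval-⌜⌝ ([] ▸ letter (suc k₁ ℕ.+ k₂) m₁ p₁) (valʷ x 0≤x)) (val-merge x 0≤x k₁ k₂ m₁ p₁ p₂)
  ... | no m₁≢m₂ = eval-partialFraction x 0≤x k₁ m₁ p₁ k₂ m₂ p₂ m₁≢m₂

  ⊙ₚ-val : ∀ x .(0≤x : 0ℚ ≤ x) L M → eval (L ⊙ₚ M) (valʷ x 0≤x) ≡ eval L (valʷ x 0≤x) * eval M (valʷ x 0≤x)
  ⊙ₚ-val x 0≤x L M = begin
      eval (L ⊙ₚ M) v                                  ≡⟨ eval-bilinear _⊙ʷ_ L M v ⟩
      eval L (λ u → eval M (λ w → eval (u ⊙ʷ w) v))    ≡⟨ (eval-cong L λ u → trans (eval-cong M (⊙ʷ-val u)) (eval-* M (v u) v)) ⟩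
      eval L (λ u → v u * eval M v)                    ≡⟨ (eval-cong L λ u → ℚP.*-comm (v u) (eval M v)) ⟩
      eval L (λ u → eval M v * v u)                    ≡⟨ eval-* L (eval M v) v ⟩
      eval M v * eval L v                              ≡⟨ ℚP.*-comm (eval M v) (eval L v) ⟩
      eval L v * eval M v                              ∎
    where
    open ≡-Reasoning
    v : Word → ℚ
    v = valʷ x 0≤x
    ⊙ʷ-val : ∀ u w → eval (u ⊙ʷ w) v ≡ v u * v w
    ⊙ʷ-val ([] ▸ a)      ([] ▸ b)      = ⊙-val x 0≤x a b
    ⊙ʷ-val []            w             = sym (ℚP.*-zeroˡ (v w))
    ⊙ʷ-val ((_ ▸ _) ▸ _) w             = sym (ℚP.*-zeroˡ (v w))
    ⊙ʷ-val ([] ▸ a)      []            = sym (ℚP.*-zeroʳ (val x 0≤x a))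
    ⊙ʷ-val ([] ▸ a)      ((_ ▸ _) ▸ _) = sym (ℚP.*-zeroʳ (val x 0≤x a))

  letterComb-letters : ∀ {p} → LetterComb p → List Letter
  letterComb-letters []              = []
  letterComb-letters ((a , _) ∷ isL) = a ∷ letterComb-letters isL

  support⊆letters : ∀ {p} (isL : LetterComb p) {w} → w ∈ support p → Σ Letter λ a → w ≡ [] ▸ a × a ∈ letterComb-letters isL
  support⊆letters ((a , refl) ∷ isL) (here refl) = a , refl , here refl
  support⊆letters (_ ∷ isL)          (there w∈) with support⊆letters isL w∈
  ... | a , w≡ , a∈ = a , w≡ , there a∈

  letterSupport : ∀ {p} → LetterComb p → List Letter
  letterSupport isL = deduplicate _≟L_ (letterComb-letters isL)

  support⊆letterSupport : ∀ {p} (isL : LetterComb p) {w} → w ∈ support p → w ∈ map ([] ▸_) (letterSupport isL)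
  support⊆letterSupport isL w∈ with support⊆letters isL w∈
  ... | a , refl , a∈ = ∈-map⁺ ([] ▸_) (∈-deduplicate⁺ _≟L_ a∈)

  letterComb-zero : ∀ p → LetterComb p → (∀ x → .(0≤x : 0ℚ ≤ x) → eval p (valʷ x 0≤x) ≡ 0ℚ) → ∀ w → coeff p w ≡ 0ℚ
  letterComb-zero p isL vanishes w = by-cases (w ∈? map ([] ▸_) ls)
    where
    ls : List Letter
    ls = letterSupport isL
    vanishes′ : VanishesOn (λ a → coeff p ([] ▸ a)) ls
    vanishes′ x 0≤x = begin
        ∑ ls (λ a → coeff p ([] ▸ a) * val x 0≤x a)
      ≡⟨ ∑-map ([] ▸_) ls (λ w → coeff p w * valʷ x 0≤x w) ⟨
        ∑ (map ([] ▸_) ls) (λ w → coeff p w * valʷ x 0≤x w)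
      ≡⟨ eval≈∑-coeff (map ([] ▸_) ls) p (valʷ x 0≤x)
                      (Unique.map⁺ (λ { refl → refl }) (deduplicate-! _≟L_ (letterComb-letters isL)))
                      (support⊆letterSupport isL) ⟨
        eval p (valʷ x 0≤x)
      ≡⟨ vanishes x 0≤x ⟩
        0ℚ ∎
      where open ≡-Reasoning
    by-cases : Dec (w ∈ map ([] ▸_) ls) → coeff p w ≡ 0ℚ
    by-cases (no w∉)  = coeff-∉ p w λ w∈ → w∉ (support⊆letterSupport isL w∈)
    by-cases (yes w∈) with ∈-map⁻ ([] ▸_) w∈
    ... | a , a∈ , refl =
      All.lookup (partialFractions-independent ls (deduplicate-! _≟L_ (letterComb-letters isL)) (λ a → coeff p ([] ▸ a)) vanishes′) a∈

  letterComb-injective : ∀ P Q → LetterComb P → LetterComb Q →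
                         (∀ x → .(0≤x : 0ℚ ≤ x) → eval P (valʷ x 0≤x) ≡ eval Q (valʷ x 0≤x)) → P ≈ₚ Q
  letterComb-injective P Q isP isQ same-values w =
    trans (a≡a-b+b (coeff P w) (coeff Q w))
          (trans (cong (_+ coeff Q w) (trans (sym (coeff-difference w)) (letterComb-zero D isD D-vanishes w)))
                 (ℚP.+-identityˡ (coeff Q w)))
    where
    D : Poly
    D = P ++ (- 1ℚ) • Q
    isD : LetterComb D
    isD = ++-letterComb isP (•-letterComb (- 1ℚ) isQ)
    a≡a-b+b : ∀ a b → a ≡ (a + (- 1ℚ) * b) + b
    a≡a-b+b = solve 2 (λ a b → a := (a :+ (:- con 1ℚ) :* b) :+ b) refl
    a-a≡0 : ∀ a → a + (- 1ℚ) * a ≡ 0ℚ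
    a-a≡0 = solve 1 (λ a → a :+ (:- con 1ℚ) :* a := con 0ℚ) refl
    coeff-difference : ∀ w → coeff D w ≡ coeff P w + (- 1ℚ) * coeff Q w
    coeff-difference w = trans (coeff-++ P _ w) (cong (coeff P w +_) (coeff-• (- 1ℚ) Q w))
    D-vanishes : ∀ x → .(0≤x : 0ℚ ≤ x) → eval D (valʷ x 0≤x) ≡ 0ℚ
    D-vanishes x 0≤x = trans (eval-++ P _ (valʷ x 0≤x))
      (trans (cong₂ (λ a b → a + b) (same-values x 0≤x) (eval-• (- 1ℚ) Q (valʷ x 0≤x))) (a-a≡0 (eval Q (valʷ x 0≤x))))

  ⊙-comm : ∀ a b → a ⊙ b ≈ₚ b ⊙ a
  ⊙-comm a b = letterComb-injective (a ⊙ b) (b ⊙ a) (⊙-letterComb a b) (⊙-letterComb b a) λ x 0≤x →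
    trans (⊙-val x 0≤x a b) (trans (ℚP.*-comm (val x 0≤x a) (val x 0≤x b)) (sym (⊙-val x 0≤x b a)))

  ⊙-assoc : ∀ a b c → (a ⊙ b) ⊙ₚ ⌜ c ⌝ˡ ≈ₚ ⌜ a ⌝ˡ ⊙ₚ (b ⊙ c)
  ⊙-assoc a b c = letterComb-injective ((a ⊙ b) ⊙ₚ ⌜ c ⌝ˡ) (⌜ a ⌝ˡ ⊙ₚ (b ⊙ c))
                    (⊙ₚ-letterComb (a ⊙ b) ⌜ c ⌝ˡ) (⊙ₚ-letterComb ⌜ a ⌝ˡ (b ⊙ c)) λ x 0≤x → begin
      eval ((a ⊙ b) ⊙ₚ ⌜ c ⌝ˡ) (valʷ x 0≤x)                   ≡⟨ ⊙ₚ-val x 0≤x (a ⊙ b) ⌜ c ⌝ˡ ⟩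
      eval (a ⊙ b) (valʷ x 0≤x) * eval ⌜ c ⌝ˡ (valʷ x 0≤x)     ≡⟨ cong₂ _*_ (⊙-val x 0≤x a b) (eval-⌜⌝ ([] ▸ c) (valʷ x 0≤x)) ⟩
      val x 0≤x a * val x 0≤x b * val x 0≤x c                 ≡⟨ ℚP.*-assoc (val x 0≤x a) (val x 0≤x b) (val x 0≤x c) ⟩
      val x 0≤x a * (val x 0≤x b * val x 0≤x c)               ≡⟨ cong₂ _*_ (eval-⌜⌝ ([] ▸ a) (valʷ x 0≤x)) (⊙-val x 0≤x b c) ⟨
      eval ⌜ a ⌝ˡ (valʷ x 0≤x) * eval (b ⊙ c) (valʷ x 0≤x)     ≡⟨ ⊙ₚ-val x 0≤x ⌜ a ⌝ˡ (b ⊙ c) ⟨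
      eval (⌜ a ⌝ˡ ⊙ₚ (b ⊙ c)) (valʷ x 0≤x)                   ∎
    where open ≡-Reasoning

module Transfer {c ℓ : Level} (R : CommutativeRing c ℓ)
                (ι : ℚ → CommutativeRing.Carrier R)
                (hom : IsRingHomomorphism +-*-rawRing (CommutativeRing.rawRing R) ι)
                (μ : CommutativeRing.Carrier R)
                (A B : Coeffs) where
  open import Data.Rational.Base as ℚ using (0ℚ)
  open import Data.List.Properties using (map-++)
  open CommutativeRing R
  open IsRingHomomorphism hom using (+-homo; *-homo; 0#-homo; 1#-homo)
  open Stuffle R ι μ A B
  open Evaluation R ι μ A B
  open import Relation.Binary.Reasoning.Setoid setoid
  module Q  = Stuffle ℚP.+-*-commutativeRing (λ q → q) 0ℚ A B
  module QL = Evaluation ℚP.+-*-commutativeRing (λ q → q) 0ℚ A B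

  mapι : Q.Poly → Poly
  mapι = map λ { (q , w) → (ι q , w) }

  coeff-mapι : ∀ p w → coeff (mapι p) w ≈ ι (Q.coeff p w)
  coeff-mapι []            w = sym 0#-homo
  coeff-mapι ((d , u) ∷ p) w with u ≟W w
  ... | yes _ = trans (+-congˡ (coeff-mapι p w)) (sym (+-homo d (Q.coeff p w)))
  ... | no  _ = coeff-mapι p w

  mapι-≈ₚ : ∀ {p q} → p Q.≈ₚ q → mapι p ≈ₚ mapι q
  mapι-≈ₚ {p} {q} p≈q w = trans (coeff-mapι p w) (trans (reflexive (≡.cong ι (p≈q w))) (sym (coeff-mapι q w)))

  eval-mapι-++ : ∀ p q f → eval (mapι (p ++ q)) f ≈ eval (mapι p) f + eval (mapι q) f
  eval-mapι-++ p q f = trans (reflexive (≡.cong (λ t → eval t f) (map-++ _ p q))) (eval-++ (mapι p) (mapι q) f)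

  eval-mapι-• : ∀ r p f → eval (mapι (r Q.• p)) f ≈ ι r * eval (mapι p) f
  eval-mapι-• r []            f = sym (zeroʳ (ι r))
  eval-mapι-• r ((d , u) ∷ p) f =
    trans (+-cong (trans (*-congʳ (*-homo r d)) (*-assoc _ _ _)) (eval-mapι-• r p f)) (sym (distribˡ _ _ _))

  eval-mapι-bilinear : ∀ F p q f →
    eval (mapι (QL.bilinear F p q)) f ≈ eval (mapι p) (λ u → eval (mapι q) (λ v → eval (mapι (F u v)) f))
  eval-mapι-bilinear F []            q f = refl
  eval-mapι-bilinear F ((d , u) ∷ p) q f = begin
      eval (mapι (row q ++ QL.bilinear F p q)) f
    ≈⟨ eval-mapι-++ (row q) _ f ⟩
      eval (mapι (row q)) f + eval (mapι (QL.bilinear F p q)) f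
    ≈⟨ +-cong (eval-row q) (eval-mapι-bilinear F p q f) ⟩
      ι d * eval (mapι q) (λ v → eval (mapι (F u v)) f) + eval (mapι p) (λ u → eval (mapι q) (λ v → eval (mapι (F u v)) f)) ∎
    where
    row : Q.Poly → Q.Poly
    row q = concatMap (λ { (e , v) → (d ℚ.* e) Q.• F u v }) q
    eval-row : ∀ q → eval (mapι (row q)) f ≈ ι d * eval (mapι q) (λ v → eval (mapι (F u v)) f)
    eval-row []            = sym (zeroʳ (ι d))
    eval-row ((e , v) ∷ q) = begin
        eval (mapι ((d ℚ.* e) Q.• F u v ++ row q)) f
      ≈⟨ eval-mapι-++ ((d ℚ.* e) Q.• F u v) (row q) f ⟩
        eval (mapι ((d ℚ.* e) Q.• F u v)) f + eval (mapι (row q)) f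
      ≈⟨ +-cong (trans (eval-mapι-• (d ℚ.* e) (F u v) f) (trans (*-congʳ (*-homo d e)) (*-assoc _ _ _))) (eval-row q) ⟩
        ι d * (ι e * eval (mapι (F u v)) f) + ι d * eval (mapι q) (λ v → eval (mapι (F u v)) f)
      ≈⟨ distribˡ _ _ _ ⟨
        ι d * (ι e * eval (mapι (F u v)) f + eval (mapι q) (λ v → eval (mapι (F u v)) f)) ∎

  letters-mapι : ∀ n f q .(pos : ℚ.Positive q) → letters n f q pos ≡ mapι (Q.letters n f q pos)
  letters-mapι zero    f q pos = ≡.refl
  letters-mapι (suc n) f q pos = ≡.trans (≡.cong (_++ _) (letters-mapι n f q pos)) (≡.sym (map-++ _ (Q.letters n f q pos) _))

  ⌜⌝-mapι : ∀ u → ⌜ u ⌝ ≋ mapι QL.⌜ u ⌝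
  ⌜⌝-mapι u = by-eval λ f → +-congʳ (*-congʳ (sym 1#-homo))

  ⊙-mapι : ∀ a b → a ⊙ b ≋ mapι (a Q.⊙ b)
  ⊙-mapι (letter k₁ m₁ p₁) (letter k₂ m₂ p₂) with m₁ ℚP.≟ m₂
  ... | yes _ = ⌜⌝-mapι ([] ▸ letter (suc k₁ ℕ.+ k₂) m₁ p₁)
  ... | no  _ = by-eval λ f → reflexive (≡.cong (λ t → eval t f)
      (≡.trans (≡.cong₂ _++_ (letters-mapι (suc k₁) (A (suc k₁) m₁ (suc k₂) m₂) m₁ p₁)
                               (letters-mapι (suc k₂) (B (suc k₁) m₁ (suc k₂) m₂) m₂ p₂))
               (≡.sym (map-++ _ (Q.letters (suc k₁) (A (suc k₁) m₁ (suc k₂) m₂) m₁ p₁) _))))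

  ⊙ₚ-mapι : ∀ L M → mapι L ⊙ₚ mapι M ≋ mapι (L QL.⊙ₚ M)
  ⊙ₚ-mapι L M = by-eval λ f → begin
      eval (mapι L ⊙ₚ mapι M) f
    ≈⟨ eval-bilinear _⊙ʷ_ (mapι L) (mapι M) f ⟩
      eval (mapι L) (λ u → eval (mapι M) (λ v → eval (u ⊙ʷ v) f))
    ≈⟨ (eval-cong (mapι L) λ u → eval-cong (mapι M) λ v → eval-≈ (⊙ʷ-mapι u v) f) ⟩
      eval (mapι L) (λ u → eval (mapι M) (λ v → eval (mapι (u QL.⊙ʷ v)) f))
    ≈⟨ eval-mapι-bilinear QL._⊙ʷ_ L M f ⟨
      eval (mapι (L QL.⊙ₚ M)) f ∎
    where
    ⊙ʷ-mapι : ∀ u v → u ⊙ʷ v ≋ mapι (u QL.⊙ʷ v)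
    ⊙ʷ-mapι ([] ▸ a)      ([] ▸ b)      = ⊙-mapι a b
    ⊙ʷ-mapι []            _             = ≋-refl
    ⊙ʷ-mapι ((_ ▸ _) ▸ _) _             = ≋-refl
    ⊙ʷ-mapι ([] ▸ _)      []            = ≋-refl
    ⊙ʷ-mapι ([] ▸ _)      ((_ ▸ _) ▸ _) = ≋-refl

module LetterLaws {c ℓ : Level} (R : CommutativeRing c ℓ)
                  (ι : ℚ → CommutativeRing.Carrier R)
                  (hom : IsRingHomomorphism +-*-rawRing (CommutativeRing.rawRing R) ι)
                  (μ : CommutativeRing.Carrier R)
                  (A B : Coeffs) (PF : IsPartialFraction A B) where
  open Stuffle R ι μ A B
  open Evaluation R ι μ A B
  open Transfer R ι hom μ A B
  open import Relation.Binary.Reasoning.Setoid ≋-setoid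
  private module Values = LetterProducts A B PF

  mapι-≋ : ∀ p q → p Q.≈ₚ q → mapι p ≋ mapι q
  mapι-≋ p q p≈q = ≈ₚ⇒≋ {mapι p} {mapι q} (mapι-≈ₚ {p} {q} p≈q)

  ⊙-comm : ∀ a b → a ⊙ b ≋ b ⊙ a
  ⊙-comm a b = begin
    a ⊙ b                ≈⟨ ⊙-mapι a b ⟩
    mapι (a Q.⊙ b)       ≈⟨ mapι-≋ (a Q.⊙ b) (b Q.⊙ a) (Values.⊙-comm a b) ⟩
    mapι (b Q.⊙ a)       ≈⟨ ⊙-mapι b a ⟨
    b ⊙ a                ∎

  ⊙-assoc : ∀ a b c → (a ⊙ b) ⊙ₚ ⌜ c ⌝ˡ ≋ ⌜ a ⌝ˡ ⊙ₚ (b ⊙ c)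
  ⊙-assoc a b c = begin
    (a ⊙ b) ⊙ₚ ⌜ c ⌝ˡ                          ≈⟨ ⊙ₚ-cong (⊙-mapι a b) (⌜⌝-mapι ([] ▸ c)) ⟩
    mapι (a Q.⊙ b) ⊙ₚ mapι QL.⌜ c ⌝ˡ           ≈⟨ ⊙ₚ-mapι (a Q.⊙ b) QL.⌜ c ⌝ˡ ⟩
    mapι ((a Q.⊙ b) QL.⊙ₚ QL.⌜ c ⌝ˡ)           ≈⟨ mapι-≋ _ _ (Values.⊙-assoc a b c) ⟩
    mapι (QL.⌜ a ⌝ˡ QL.⊙ₚ (b Q.⊙ c))           ≈⟨ ⊙ₚ-mapι QL.⌜ a ⌝ˡ (b Q.⊙ c) ⟨
    mapι QL.⌜ a ⌝ˡ ⊙ₚ mapι (b Q.⊙ c)           ≈⟨ ⊙ₚ-cong (⌜⌝-mapι ([] ▸ a)) (⊙-mapι b c) ⟨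
    ⌜ a ⌝ˡ ⊙ₚ (b ⊙ c)                          ∎

theorem3p5 : ∀ {c ℓ : Level} (R : CommutativeRing c ℓ)
               (ι : ℚ → CommutativeRing.Carrier R) →
               IsRingHomomorphism +-*-rawRing (CommutativeRing.rawRing R) ι →
               (μ : CommutativeRing.Carrier R) →
               (A B : Coeffs) → IsPartialFraction A B →
               Stuffle.IsCommAssocUnitalAlgebra R ι μ A B
theorem3p5 R ι hom μ A B PF = record
  { ∗-cong      = λ {p} {p′} {q} {q′} p≈p′ q≈q′ → ≋⇒≈ₚ (∗-cong (≈ₚ⇒≋ {p} {p′} p≈p′) (≈ₚ⇒≋ {q} {q′} q≈q′))
  ; ∗-distribʳ  = λ p p′ q → ≋⇒≈ₚ (∗-distribʳ p p′ q)
  ; ∗-distribˡ  = λ p q q′ → ≋⇒≈ₚ (∗-distribˡ p q q′)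
  ; ∗-scalarˡ   = λ r p q → ≋⇒≈ₚ (∗-scalarˡ r p q)
  ; ∗-scalarʳ   = λ r p q → ≋⇒≈ₚ (∗-scalarʳ r p q)
  ; ∗-assoc     = λ p q s → ≋⇒≈ₚ (∗-assoc ⊙-assoc p q s)
  ; ∗-comm      = λ p q → ≋⇒≈ₚ (∗-comm ⊙-comm p q)
  ; ∗-identityˡ = λ p → ≋⇒≈ₚ (∗-identityˡ p)
  ; ∗-identityʳ = λ p → ≋⇒≈ₚ (∗-identityʳ p)
  }
  where
  open Evaluation R ι μ A B
  open StuffleLaws R ι μ A B
  open StuffleAssoc R ι μ A B using (∗-assoc)
  open LetterLaws R ι hom μ A B PF
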